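{- Let $G$ be a connected graph containing an odd cycle $C_{2k+1}=v_1v_2\cdots v_{2k+1}v_1$ such that $G-E(C_{2k+1})$ has exactly $2k+1$ components. Let $G_i$ be the component of $G-E(C_{2k+1})$ containing $v_i$, with $|E(G_i)|=m_i$, for $i=1,\dots,2k+1$. Let \[ G' = G - \sum_{i = 2}^{2k+1} \sum_{w \in N_{G_i}(v_i)} wv_i + \sum_{i = 2}^{2k+1} \sum_{w \in N_{G_i}(v_i)} wv_1, \] i.e. every edge of $G_i$ incident with $v_i$ ($2\le i\le 2k+1$) is replaced by the edge joining its other end to $v_1$. Then $W_e(G')\le W_e(G)$, with equality if and only if $C_{2k+1}$ is an end-block of $G$, that is, $G\cong G'$.
   Context: For a connected graph $G$ and edges $f=u_1u_2$, $g=v_1v_2$, $d_G(f,g)=\min\{d_G(u_i,v_j): i,j\in\{1,2\}\}+1$ if $f\neq g$, and $d_G(f,f)=0$; $W_e(G)=\sum_{\{f,g\}\subseteq E(G)} d_G(f,g)$ over unordered pairs of edges. $N_H(v)$ is the set of neighbours of $v$ in $H$. An end-block is a block containing at most one cut vertex of $G$. -}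

module Defs where

open import Data.Nat using (ℕ; zero; suc; _+_; _<_; _≤_; _⊓_; _<ᵇ_; _*_)
open import Data.Nat.Properties using (_<?_)
open import Data.Bool using (Bool; true; false; _∧_; _∨_; not; if_then_else_)
open import Data.Fin using (Fin; toℕ; fromℕ<; _≟_) renaming (zero to fzero)
open import Data.List using (List; []; _∷_; map; concatMap; allFin)
open import Data.Nat.ListAction using (sum)
import Data.Bool.ListAction as L
open import Data.Product using (_×_; _,_)
open import Relation.Nullary using (¬_; yes; no)
open import Relation.Nullary.Decidable using (⌊_⌋)
open import Relation.Binary.PropositionalEquality using (_≡_)

_==_ : ∀ {n} → Fin n → Fin n → Bool
u == v = ⌊ u ≟ v ⌋

anyF : ∀ {n} → (Fin n → Bool) → Bool
anyF {n} p = L.any p (allFin n)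

countF : ∀ {n} → (Fin n → Bool) → ℕ
countF {n} p = sum (map (λ i → if p i then 1 else 0) (allFin n))

-- A (finite, simple) graph on a subset of the vertex universe Fin n:
-- vertex set given by `vert`, adjacency by `adj`.
record Graph (n : ℕ) : Set where
  field
    vert : Fin n → Bool
    adj  : Fin n → Fin n → Bool
open Graph public

WellFormed : ∀ {n} → Graph n → Set
WellFormed {n} H =
  (∀ u v → adj H u v ≡ adj H v u) ×
  (∀ u → adj H u u ≡ false) ×
  (∀ u v → adj H u v ≡ true → (vert H u ≡ true) × (vert H v ≡ true))

reach : ∀ {n} → Graph n → ℕ → Fin n → Fin n → Bool
reach H zero    u v = (u == v) ∧ vert H u
reach H (suc k) u v = reach H k u v ∨ anyF (λ w → reach H k u w ∧ adj H w v)

-- u and v are joined by a path in H (n steps always suffice)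
Connects : ∀ {n} → Graph n → Fin n → Fin n → Set
Connects {n} H u v = reach H n u v ≡ true

Connected : ∀ {n} → Graph n → Set
Connected H = ∀ u v → vert H u ≡ true → vert H v ≡ true → Connects H u v

-- number of connected components: vertices that are the least vertex of their component
numComp : ∀ {n} → Graph n → ℕ
numComp {n} H =
  countF (λ v → vert H v ∧ not (anyF (λ u → (toℕ u <ᵇ toℕ v) ∧ reach H n u v)))

findFrom : (ℕ → Bool) → ℕ → ℕ → ℕ
findFrom p k zero       = k
findFrom p k (suc fuel) = if p k then k else findFrom p (suc k) fuel

-- graph distance d_H(u,v) (length of a shortest u–v path; meaningful when u,v are connected)
dist : ∀ {n} → Graph n → Fin n → Fin n → ℕ
dist {n} H u v = findFrom (λ k → reach H k u v) 0 n

-- edges as pairs (u , v) with u < v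
Edge : ℕ → Set
Edge n = Fin n × Fin n

edges : ∀ {n} → Graph n → List (Edge n)
edges {n} H = concatMap (λ u → concatMap (λ v →
   if (toℕ u <ᵇ toℕ v) ∧ adj H u v then (u , v) ∷ [] else []) (allFin n)) (allFin n)

-- d_H(f,g) for distinct edges f,g
edist : ∀ {n} → Graph n → Edge n → Edge n → ℕ
edist H (u₁ , u₂) (v₁ , v₂) =
  suc ((dist H u₁ v₁ ⊓ dist H u₁ v₂) ⊓ (dist H u₂ v₁ ⊓ dist H u₂ v₂))

sumPairs : ∀ {A : Set} → (A → A → ℕ) → List A → ℕ
sumPairs f []       = 0
sumPairs f (x ∷ xs) = sum (map (f x) xs) + sumPairs f xs

-- edge Wiener index (pairs {f,f} contribute 0)
We : ∀ {n} → Graph n → ℕ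
We H = sumPairs (edist H) (edges H)

_⊆G_ : ∀ {n} → Graph n → Graph n → Set
S ⊆G H = (∀ u → vert S u ≡ true → vert H u ≡ true) ×
         (∀ u v → adj S u v ≡ true → adj H u v ≡ true)

delV : ∀ {n} → Graph n → Fin n → Graph n
delV H v = record { vert = λ u → vert H u ∧ not (u == v)
                  ; adj  = λ u w → adj H u w ∧ not (u == v) ∧ not (w == v) }

IsCutVertex : ∀ {n} → Graph n → Fin n → Set
IsCutVertex H v = (vert H v ≡ true) × (numComp H < numComp (delV H v))

Nonseparable : ∀ {n} → Graph n → Set
Nonseparable H = Connected H × (∀ v → ¬ IsCutVertex H v)

IsBlock : ∀ {n} → Graph n → Graph n → Set
IsBlock G B = WellFormed B × B ⊆G G × Nonseparable B ×
  (∀ S → WellFormed S → B ⊆G S → S ⊆G G → Nonseparable S → S ⊆G B)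

IsEndBlock : ∀ {n} → Graph n → Graph n → Set
IsEndBlock G B = IsBlock G B ×
  (∀ u v → vert B u ≡ true → vert B v ≡ true →
     IsCutVertex G u → IsCutVertex G v → u ≡ v)

full : ∀ {n} → (Fin n → Fin n → Bool) → Graph n
full a = record { vert = λ _ → true ; adj = a }

next : ∀ {m} → Fin (suc m) → Fin (suc m)
next {m} i with suc (toℕ i) <? suc m
... | yes p = fromℕ< p
... | no  _ = fzero

cycE : ∀ {n m} → (Fin (suc m) → Fin n) → Fin n → Fin n → Bool
cycE c u v = anyF (λ i → ((c i == u) ∧ (c (next i) == v)) ∨ ((c i == v) ∧ (c (next i) == u)))

cycleGraph : ∀ {n m} → (Fin (suc m) → Fin n) → Graph n
cycleGraph c = record { vert = λ u → anyF (λ i → c i == u) ; adj = cycE c }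

minusCyc : ∀ {n m} → (Fin n → Fin n → Bool) → (Fin (suc m) → Fin n) → Graph n
minusCyc a c = full (λ u v → a u v ∧ not (cycE c u v))

isNonzero : ∀ {m} → Fin (suc m) → Bool
isNonzero i = not (i == fzero)

-- G' : every edge w v_i with w ∈ N_{G_i}(v_i), i ≠ 1, is replaced by w v_1
-- (here v_1 = c 0 and G_i-neighbours are the neighbours in G - E(C))
transform : ∀ {n m} → (Fin n → Fin n → Bool) → (Fin (suc m) → Fin n) → Graph n
transform a c = full (λ x y → (a x y ∧ not (removed x y)) ∨ added x y)
  where
  H = minusCyc a c
  removed : _ → _ → Bool
  removed x y = anyF (λ i → isNonzero i ∧
                  (((c i == x) ∧ adj H x y) ∨ ((c i == y) ∧ adj H y x)))
  added : _ → _ → Bool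
  added x y = ((x == c fzero) ∧ anyF (λ i → isNonzero i ∧ adj H (c i) y)) ∨
              ((y == c fzero) ∧ anyF (λ i → isNonzero i ∧ adj H (c i) x))

-- Every vertex of G lies in exactly one branch G_i, the component of G − E(C)
-- through v_i, because G − E(C) has as many components as C has vertices. The map `merge` (all cycle vertices to v₁,
-- everything else fixed) carries the edges of G − E(C) bijectively onto those
-- of G' − E(C), never increases distances, preserves them inside a branch,
-- shortens them by at least one between different branches, and distances
-- between cycle vertices do not change. Summing d(e,f) over ordered pairs of
-- oriented edges gives 8 W_e + 4|E|, which splits into cycle/cycle,
-- cycle/branch and branch/branch blocks. The first block is unchanged. A
-- cycle/branch term depends on the branch G_i only through the transmission
-- ∑_{e ∈ C} d(e, v_i), which is the same for every i because rotating C is a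
-- distance-non-increasing self-map of G. The branch/branch block can only
-- drop, and drops strictly iff two edges of G − E(C) lie in different
-- branches, i.e. iff two vertices of C are cut vertices of G, i.e. iff the
-- block C is not an end-block.
-- In the code v_(i+1) is c i, and the branch containing x is the one at c (root x).

module Submission where

open import Data.Nat hiding (_≟_)
open import Data.Nat.Properties hiding (_≟_)
open import Data.Bool using (Bool; true; false; _∧_; _∨_; not; if_then_else_)
open import Data.Bool.Properties using (∧-zeroʳ; ∧-identityʳ; ∧-comm; ∨-comm; T-≡)
open import Function.Bundles using (Equivalence)
open import Data.Fin using (Fin; toℕ; fromℕ<; fromℕ; inject₁; _≟_) renaming (zero to fzero; suc to fsuc)
open import Data.Fin.Properties using (toℕ-injective; toℕ-fromℕ<; fromℕ<-toℕ; toℕ<n; toℕ-fromℕ; toℕ-inject₁)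
open import Data.List using (List; []; _∷_; map; concatMap; allFin; tabulate; _++_)
import Data.Nat.ListAction as List using (sum)
import Data.Nat.ListAction.Properties as List using (sum-++)
import Data.Bool.ListAction as List using (any)
import Data.List.Properties as List using (map-++; map-cong)
import Data.Fin.Properties as Fin
open import Algebra.Properties.Semiring.Sum +-*-semiring
  using (sum; sum-cong-≗; sum-replicate-zero; sum-init-last; ∑-distrib-+; ∑-comm; *-distribˡ-sum; *-distribʳ-sum)
open import Algebra.Properties.CommutativeSemigroup +-commutativeSemigroup using (interchange)
open import Data.Product using (Σ; _×_; _,_; proj₁; proj₂; ∃)
open import Data.Sum using (_⊎_; inj₁; inj₂; [_,_]′)
open import Data.Empty using (⊥; ⊥-elim)
open import Data.Unit using (⊤; tt)
open import Relation.Nullary using (¬_; yes; no)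
open import Relation.Binary.Definitions using (tri<; tri≈; tri>)
open import Relation.Binary.PropositionalEquality hiding ([_])
open import Function using (_∘_; id)
open import Defs

-- Booleans, finite sums and counting

∨-l : ∀ {a} b → a ≡ true → (a ∨ b) ≡ true
∨-l b refl = refl
∨-r : ∀ a {b} → b ≡ true → (a ∨ b) ≡ true
∨-r true e = refl
∨-r false e = e
∨-elim : ∀ a b → (a ∨ b) ≡ true → a ≡ true ⊎ b ≡ true
∨-elim true b e = inj₁ refl
∨-elim false b e = inj₂ e
∧-i : ∀ {a b} → a ≡ true → b ≡ true → (a ∧ b) ≡ true
∧-i refl refl = refl
∧-l : ∀ a b → (a ∧ b) ≡ true → a ≡ true
∧-l true b e = refl
∧-r : ∀ a b → (a ∧ b) ≡ true → b ≡ true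
∧-r true b e = e
not-t : ∀ a → not a ≡ true → a ≡ false
not-t false e = refl
not-f : ∀ {a} → a ≡ false → not a ≡ true
not-f refl = refl
t≢f : ∀ {a} → a ≡ true → a ≡ false → ⊥
t≢f refl ()

bdec : ∀ b → b ≡ true ⊎ b ≡ false
bdec true = inj₁ refl
bdec false = inj₂ refl

decide : ∀ {a b} {P : Set a} {Q : Set b} → Relation.Nullary.Dec P → (P → Q) → (¬ P → Q) → Q
decide (yes p) f g = f p
decide (no np) f g = g np

bcase : ∀ {ℓ} {Q : Set ℓ} (b : Bool) → (b ≡ true → Q) → (b ≡ false → Q) → Q
bcase true f g = f refl
bcase false f g = g refl

==-refl : ∀ {n} (i : Fin n) → (i == i) ≡ true
==-refl i with i ≟ i
... | yes _ = refl
... | no ne = ⊥-elim (ne refl)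

==-sound : ∀ {n} {i j : Fin n} → (i == j) ≡ true → i ≡ j
==-sound {i = i} {j} e with i ≟ j
... | yes p = p
==-sound () | no _

==-false : ∀ {n} {i j : Fin n} → ¬ i ≡ j → (i == j) ≡ false
==-false {i = i} {j} ne with i ≟ j
... | yes p = ⊥-elim (ne p)
... | no _ = refl

==-false' : ∀ {n} {i j : Fin n} → (i == j) ≡ false → ¬ i ≡ j
==-false' {i = i} {j} e refl rewrite ==-refl i = t≢f refl e

anyL-tab : ∀ {A : Set} n (p : A → Bool) (h : Fin n → A) → List.any p (tabulate h) ≡ true → ∃ λ i → p (h i) ≡ true
anyL-tab zero p h ()
anyL-tab (suc n) p h e with p (h fzero) in eq
... | true = fzero , eq
... | false with anyL-tab n p (h ∘ fsuc) e
... | i , q = fsuc i , q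

anyF-elim : ∀ {n} (p : Fin n → Bool) → anyF p ≡ true → ∃ λ i → p i ≡ true
anyF-elim {n} p e = anyL-tab n p id e

anyL-tab-intro : ∀ {A : Set} n (p : A → Bool) (h : Fin n → A) (i : Fin n) → p (h i) ≡ true → List.any p (tabulate h) ≡ true
anyL-tab-intro (suc n) p h fzero e rewrite e = refl
anyL-tab-intro (suc n) p h (fsuc i) e with p (h fzero)
... | true = refl
... | false = anyL-tab-intro n p (h ∘ fsuc) i e

anyF-intro : ∀ {n} (p : Fin n → Bool) (i : Fin n) → p i ≡ true → anyF p ≡ true
anyF-intro {n} p i e = anyL-tab-intro n p id i e

anyF-false : ∀ {n} (p : Fin n → Bool) → (∀ i → p i ≡ false) → anyF p ≡ false
anyF-false {n} p e with anyF p in eq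
... | false = refl
... | true with anyF-elim p eq
... | i , pi = trans (sym pi) (e i)

anyF-cong : ∀ {N} {p q : Fin N → Bool} → (∀ i → p i ≡ q i) → anyF p ≡ anyF q
anyF-cong {p = p} {q} e with bdec (anyF p) | bdec (anyF q)
... | inj₁ x | inj₁ y = trans x (sym y)
... | inj₂ x | inj₂ y = trans x (sym y)
... | inj₁ x | inj₂ y with anyF-elim p x
... | i , pi = ⊥-elim (t≢f (anyF-intro q i (trans (sym (e i)) pi)) y)
anyF-cong {p = p} {q} e | inj₂ x | inj₁ y with anyF-elim q y
... | i , qi = ⊥-elim (t≢f (anyF-intro p i (trans (e i) qi)) x)

[_] : Bool → ℕ
[ b ] = if b then 1 else 0

sum-zero : ∀ {n} {f : Fin n → ℕ} → (∀ i → f i ≡ 0) → sum f ≡ 0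
sum-zero {n} e = trans (sum-cong-≗ e) (sum-replicate-zero n)

sum-single : ∀ {n} {f : Fin n → ℕ} (x : Fin n) → (∀ i → ¬ i ≡ x → f i ≡ 0) → sum f ≡ f x
sum-single {f = f} fzero e = trans (cong (f fzero +_) (sum-zero (λ i → e (fsuc i) λ ()))) (+-identityʳ _)
sum-single {f = f} (fsuc x) e rewrite e fzero (λ ()) = sum-single x (λ i ne → e (fsuc i) (ne ∘ Fin.suc-injective))

sum-mono-≤ : ∀ {n} {f g : Fin n → ℕ} → (∀ i → f i ≤ g i) → sum f ≤ sum g
sum-mono-≤ {zero} e = z≤n
sum-mono-≤ {suc n} e = +-mono-≤ (e fzero) (sum-mono-≤ (e ∘ fsuc))

sum-mono-< : ∀ {n} {f g : Fin n → ℕ} → (∀ i → f i ≤ g i) → (x : Fin n) → f x < g x → sum f < sum g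
sum-mono-< e fzero lt = +-mono-<-≤ lt (sum-mono-≤ (e ∘ fsuc))
sum-mono-< e (fsuc x) lt = +-mono-≤-< (e fzero) (sum-mono-< (e ∘ fsuc) x lt)

sum-mono-≤-≡⇒≡ : ∀ {n} {f g : Fin n → ℕ} → (∀ i → f i ≤ g i) → sum f ≡ sum g → ∀ i → f i ≡ g i
sum-mono-≤-≡⇒≡ le eq i with m≤n⇒m<n∨m≡n (le i)
... | inj₂ e = e
... | inj₁ lt = ⊥-elim (<-irrefl eq (sum-mono-< le i lt))

lsum : ∀ {A : Set} → (A → ℕ) → List A → ℕ
lsum F xs = List.sum (map F xs)

lsum-++ : ∀ {A : Set} (F : A → ℕ) xs ys → lsum F (xs ++ ys) ≡ lsum F xs + lsum F ys
lsum-++ F xs ys = trans (cong List.sum (List.map-++ F xs ys)) (List.sum-++ (map F xs) (map F ys))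

lsum-concatMap : ∀ {A B : Set} (F : B → ℕ) (g : A → List B) xs →
  lsum F (concatMap g xs) ≡ lsum (λ x → lsum F (g x)) xs
lsum-concatMap F g [] = refl
lsum-concatMap F g (x ∷ xs) = trans (lsum-++ F (g x) (concatMap g xs)) (cong (lsum F (g x) +_) (lsum-concatMap F g xs))

lsum-tab : ∀ {A : Set} n (F : A → ℕ) (h : Fin n → A) → lsum F (tabulate h) ≡ sum (F ∘ h)
lsum-tab zero F h = refl
lsum-tab (suc n) F h = cong (F (h fzero) +_) (lsum-tab n F (h ∘ fsuc))

lsum-allFin : ∀ n (F : Fin n → ℕ) → lsum F (allFin n) ≡ sum F
lsum-allFin n F = lsum-tab n F id

lsum-cong : ∀ {A : Set} {F G : A → ℕ} (xs : List A) → (∀ x → F x ≡ G x) → lsum F xs ≡ lsum G xs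
lsum-cong xs e = cong List.sum (List.map-cong e xs)

<ᵇ≡true⇒< : ∀ a b → (a <ᵇ b) ≡ true → a < b
<ᵇ≡true⇒< a b e = <ᵇ⇒< a b (Equivalence.from T-≡ e)

<⇒<ᵇ≡true : ∀ {a b} → a < b → (a <ᵇ b) ≡ true
<⇒<ᵇ≡true lt = Equivalence.to T-≡ (<⇒<ᵇ lt)

leastFin : ∀ {N} (p : Fin N → Bool) {x} → p x ≡ true → Σ (Fin N) λ w → p w ≡ true × (∀ u → toℕ u < toℕ w → p u ≡ false)
leastFin {suc N} p {x} px with p fzero in e0
... | true = fzero , e0 , λ u ()
... | false with x
... | fzero = ⊥-elim (t≢f px e0)
... | fsuc x' with leastFin (p ∘ fsuc) {x'} px
... | w , pw , mn = fsuc w , pw , h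
  where h : ∀ u → toℕ u < suc (toℕ w) → p u ≡ false
        h fzero _ = e0
        h (fsuc u) (s≤s lt) = mn u lt

term≤sum : ∀ {n} (f : Fin n → ℕ) (x : Fin n) → f x ≤ sum f
term≤sum f fzero = m≤m+n _ _
term≤sum f (fsuc x) = ≤-trans (term≤sum (f ∘ fsuc) x) (m≤n+m _ _)

count : ∀ {n} → (Fin n → Bool) → ℕ
count p = sum (λ i → [ p i ])

countF-sum : ∀ {n} (p : Fin n → Bool) → countF p ≡ count p
countF-sum {n} p = lsum-allFin n (λ i → [ p i ])

[]≤1 : ∀ b → [ b ] ≤ 1
[]≤1 true = s≤s z≤n
[]≤1 false = z≤n

[]-mono : ∀ {a b} → (a ≡ true → b ≡ true) → [ a ] ≤ [ b ]
[]-mono {false} f = z≤n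
[]-mono {true} f rewrite f refl = s≤s z≤n

count≤size : ∀ {n} (p : Fin n → Bool) → count p ≤ n
count≤size {zero} p = z≤n
count≤size {suc n} p = +-mono-≤ ([]≤1 (p fzero)) (count≤size (p ∘ fsuc))

count-full : ∀ {n} (p : Fin n → Bool) → n ≤ count p → ∀ i → p i ≡ true
count-full {suc n} p le i with p fzero in eq
count-full {suc n} p le fzero | true = eq
count-full {suc n} p (s≤s le) (fsuc i) | true = count-full (p ∘ fsuc) le i
... | false = ⊥-elim (<-irrefl refl (≤-trans le (count≤size (p ∘ fsuc))))

count-mono-< : ∀ {n} (p q : Fin n → Bool) → (∀ v → p v ≡ true → q v ≡ true) →
  (x : Fin n) → p x ≡ false → q x ≡ true → count p < count q
count-mono-< p q h x px qx =
  sum-mono-< (λ i → []-mono (h i)) x (subst (λ b → [ b ] < [ q x ]) (sym px) (subst (λ b → 0 < [ b ]) (sym qx) (s≤s z≤n)))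

count≤1 : ∀ {n} (p : Fin n → Bool) → (∀ i j → p i ≡ true → p j ≡ true → i ≡ j) → count p ≤ 1
count≤1 p u = bcase (anyF p)
  (λ t → let (i0 , pi0) = anyF-elim p t in
     ≤-trans (≤-reflexive (sum-single i0 (λ j ne → bcase (p j) (λ pj → ⊥-elim (ne (u j i0 pj pi0))) (λ f → cong [_] f)))) ([]≤1 (p i0)))
  (λ f → ≤-trans (≤-reflexive (sum-zero (λ i → bcase (p i) (λ t → ⊥-elim (t≢f (anyF-intro p i t) f)) (λ f' → cong [_] f')))) z≤n)

count≥1 : ∀ {n} (p : Fin n → Bool) i → p i ≡ true → 1 ≤ count p
count≥1 p i t = ≤-trans (≤-reflexive (cong [_] (sym t))) (term≤sum (λ i → [ p i ]) i)

count≥2 : ∀ {n} (p : Fin n → Bool) i j → p i ≡ true → p j ≡ true → ¬ i ≡ j → 2 ≤ count p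
count≥2 p fzero fzero pi pj ne = ⊥-elim (ne refl)
count≥2 p fzero (fsuc j) pi pj ne rewrite pi = s≤s (count≥1 (p ∘ fsuc) j pj)
count≥2 p (fsuc i) fzero pi pj ne rewrite pj = s≤s (count≥1 (p ∘ fsuc) i pi)
count≥2 p (fsuc i) (fsuc j) pi pj ne = ≤-trans (count≥2 (p ∘ fsuc) i j pi pj (λ e → ne (cong fsuc e))) (m≤n+m _ _)

count-injection : ∀ {n m} (p : Fin n → Bool) (q : Fin m → Bool) (f : Fin n → Fin m) →
  (∀ x → p x ≡ true → q (f x) ≡ true) → (∀ x y → p x ≡ true → p y ≡ true → f x ≡ f y → x ≡ y) →
  count p ≤ count q
count-injection p q f pq inj = begin
    count p                                      ≡⟨ sum-cong-≗ (λ x → sym (fibres x)) ⟩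
    sum (λ x → sum (λ i → [ p x ∧ (f x == i) ])) ≡⟨ ∑-comm (λ x i → [ p x ∧ (f x == i) ]) ⟩
    sum (λ i → count (λ x → p x ∧ (f x == i)))   ≤⟨ sum-mono-≤ fibre≤ ⟩
    count q                                      ∎
  where
  open ≤-Reasoning
  fibres : ∀ x → sum (λ i → [ p x ∧ (f x == i) ]) ≡ [ p x ]
  fibres x = trans (sum-single (f x) (λ i ne → cong [_] (trans (cong (p x ∧_) (==-false (ne ∘ sym))) (∧-zeroʳ (p x)))))
                   (cong [_] (trans (cong (p x ∧_) (==-refl (f x))) (∧-identityʳ (p x))))
  in-fibre : ∀ {i} x → (p x ∧ (f x == i)) ≡ true → p x ≡ true × f x ≡ i
  in-fibre x e = ∧-l _ _ e , ==-sound (∧-r (p x) _ e)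
  fibre≤ : ∀ i → count (λ x → p x ∧ (f x == i)) ≤ [ q i ]
  fibre≤ i = bcase (q i)
    (λ t → subst (λ b → count (λ x → p x ∧ (f x == i)) ≤ [ b ]) (sym t)
             (count≤1 _ λ x y ex ey → let (px , fx) = in-fibre x ex ; (py , fy) = in-fibre y ey in inj x y px py (trans fx (sym fy))))
    (λ fl → ≤-trans (≤-reflexive (sum-zero λ x → cong [_] (bcase (p x ∧ (f x == i))
             (λ e → let (px , fx) = in-fibre x e in ⊥-elim (t≢f (subst (λ j → q j ≡ true) fx (pq x px)) fl)) id))) z≤n)

next-lt : ∀ {m'} (i : Fin (suc m')) → suc (toℕ i) < suc m' → toℕ (next i) ≡ suc (toℕ i)
next-lt {m'} i lt with suc (toℕ i) <? suc m'
... | yes p = toℕ-fromℕ< p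
... | no np = ⊥-elim (np lt)

next-ge : ∀ {m'} (i : Fin (suc m')) → ¬ suc (toℕ i) < suc m' → next i ≡ fzero
next-ge {m'} i nlt with suc (toℕ i) <? suc m'
... | yes p = ⊥-elim (nlt p)
... | no np = refl

next-inj₁ : ∀ {m'} (j : Fin m') → next (inject₁ j) ≡ fsuc j
next-inj₁ {m'} j = toℕ-injective (trans (next-lt (inject₁ j) lt) (cong suc (toℕ-inject₁ j)))
  where lt : suc (toℕ (inject₁ j)) < suc m'
        lt rewrite toℕ-inject₁ j = s≤s (toℕ<n j)

next-last : ∀ {m'} → next (fromℕ m') ≡ fzero
next-last {m'} = next-ge (fromℕ m') (λ lt → <-irrefl refl (≤-pred (subst (λ t → suc t < suc m') (toℕ-fromℕ m') lt)))

next-cases : ∀ {m'} (i : Fin (suc m')) → (toℕ i < m' × toℕ (next i) ≡ suc (toℕ i)) ⊎ (toℕ i ≡ m' × next i ≡ fzero)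
next-cases {m'} i with suc (toℕ i) <? suc m'
... | yes p = inj₁ (≤-pred p , toℕ-fromℕ< p)
... | no np = inj₂ (≤-antisym (≤-pred (toℕ<n i)) (≮⇒≥ (λ lt → np (s≤s lt))) , refl)

next-neq : ∀ {m'} → 1 ≤ m' → (i : Fin (suc m')) → ¬ next i ≡ i
next-neq {m'} le i e with next-cases i
... | inj₁ (_ , a) = <-irrefl refl (subst (toℕ i <_) (trans (sym a) (cong toℕ e)) ≤-refl)
... | inj₂ (a , b) with trans (cong toℕ (sym b)) (cong toℕ e)
... | z = <-irrefl refl (≤-trans le (≤-reflexive (trans (sym a) (sym z))))

next2-neq : ∀ {m'} → 2 ≤ m' → (i : Fin (suc m')) → ¬ next (next i) ≡ i
next2-neq {m'} le i e with next-cases i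
next2-neq {m'} le i e | inj₂ (a , b) with next-cases (next i)
... | inj₁ (_ , c) = <-irrefl refl (≤-trans le (≤-reflexive (trans (sym a) (trans (sym (cong toℕ e)) (trans c (cong (λ t → suc (toℕ t)) b))))))
... | inj₂ (c , _) = <-irrefl refl (≤-trans (≤-trans (s≤s z≤n) le) (≤-reflexive (trans (sym c) (cong toℕ b))))
next2-neq {m'} le i e | inj₁ (lt , a) with next-cases (next i)
... | inj₁ (_ , c) = <-irrefl refl (≤-trans (n≤1+n (suc (toℕ i))) (≤-reflexive (trans (cong suc (sym a)) (trans (sym c) (cong toℕ e)))))
... | inj₂ (c , d) = <-irrefl refl (≤-trans le (≤-reflexive (trans (sym c) (trans a (cong suc (trans (sym (cong toℕ e)) (cong toℕ d)))))))

sum-next : ∀ {m'} (f : Fin (suc m') → ℕ) → sum (f ∘ next) ≡ sum f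
sum-next {m'} f = trans (sum-init-last (f ∘ next))
  (trans (cong₂ _+_ (sum-cong-≗ (λ j → cong f (next-inj₁ j))) (cong f next-last)) (+-comm _ (f fzero)))

fromℕ<-suc : ∀ {m'} t (lt : suc t < suc m') → fromℕ< lt ≡ next (fromℕ< (≤-trans (n≤1+n (suc t)) lt))
fromℕ<-suc {m'} t lt = toℕ-injective (trans (toℕ-fromℕ< lt) (sym (trans (next-lt (fromℕ< lt') lt″) (cong suc (toℕ-fromℕ< lt')))))
  where
  lt' = ≤-trans (n≤1+n (suc t)) lt
  lt″ = subst (λ z → suc z < suc m') (sym (toℕ-fromℕ< lt')) lt

next-invariant : ∀ {m'} (f : Fin (suc m') → ℕ) → (∀ i → f (next i) ≤ f i) → ∀ i → f i ≡ f fzero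
next-invariant {m'} f f-next≤ i = subst (λ j → f j ≡ f fzero) (fromℕ<-toℕ i (toℕ<n i)) (from0 (toℕ i) (toℕ<n i))
  where
  f-next : ∀ i → f (next i) ≡ f i
  f-next = sum-mono-≤-≡⇒≡ f-next≤ (sum-next f)
  from0 : ∀ t (lt : t < suc m') → f (fromℕ< lt) ≡ f fzero
  from0 zero lt = refl
  from0 (suc t) lt = trans (cong f (fromℕ<-suc t lt)) (trans (f-next _) (from0 t (≤-trans (n≤1+n (suc t)) lt)))

-- Walks, distances and components

record Reach {n} (K : Graph n) (k : ℕ) (u v : Fin n) : Set where
  constructor mkR
  field get : reach K k u v ≡ true
open Reach public

module Walks {n : ℕ} (K : Graph n) where

  reach-zero : ∀ {u v} → Reach K 0 u v → u ≡ v × vert K u ≡ true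
  reach-zero {u} {v} (mkR e) = ==-sound (∧-l (u == v) _ e) , ∧-r (u == v) _ e

  reach-refl : ∀ {u} → vert K u ≡ true → Reach K 0 u u
  reach-refl {u} e = mkR (∧-i (==-refl u) e)

  reach-suc : ∀ {k u v} → Reach K (suc k) u v →
            Reach K k u v ⊎ ∃ λ w → Reach K k u w × adj K w v ≡ true
  reach-suc {k} {u} {v} (mkR e) with ∨-elim (reach K k u v) _ e
  ... | inj₁ x = inj₁ (mkR x)
  ... | inj₂ y with anyF-elim _ y
  ... | w , q = inj₂ (w , mkR (∧-l _ _ q) , ∧-r (reach K k u w) _ q)

  reach-mono : ∀ {k u v} → Reach K k u v → Reach K (suc k) u v
  reach-mono (mkR e) = mkR (∨-l _ e)

  reach-step : ∀ {k u w v} → Reach K k u w → adj K w v ≡ true → Reach K (suc k) u v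
  reach-step {k} {u} {w} {v} (mkR r) a = mkR (∨-r (reach K k u v) (anyF-intro (λ w → reach K k u w ∧ adj K w v) w (∧-i r a)))

  reach-le : ∀ {k j u v} → k ≤ j → Reach K k u v → Reach K j u v
  reach-le {k} {j} le e with m≤n⇒m<n∨m≡n le
  ... | inj₂ refl = e
  reach-le {k} {suc j} le e | inj₁ (s≤s lt) = reach-mono (reach-le lt e)

  reach-src : ∀ {k u v} → Reach K k u v → vert K u ≡ true
  reach-src {zero} e = proj₂ (reach-zero e)
  reach-src {suc k} e with reach-suc e
  ... | inj₁ x = reach-src x
  ... | inj₂ (w , r , _) = reach-src r

  reach-concat : ∀ {j k u w v} → Reach K j u w → Reach K k w v → Reach K (j + k) u v
  reach-concat {j} {zero} r e with reach-zero e
  ... | refl , _ rewrite +-identityʳ j = r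
  reach-concat {j} {suc k} r e rewrite +-suc j k with reach-suc e
  ... | inj₁ x = reach-mono (reach-concat r x)
  ... | inj₂ (x , q , a) = reach-step (reach-concat r q) a

  reach-first-step : ∀ {k u v} → Reach K k u v → ¬ u ≡ v → ∃ λ w → adj K u w ≡ true
  reach-first-step {zero} e ne = ⊥-elim (ne (proj₁ (reach-zero e)))
  reach-first-step {suc k} {u} e ne with reach-suc e
  ... | inj₁ x = reach-first-step x ne
  ... | inj₂ (w , q , a) with u ≟ w
  ... | yes refl = _ , a
  ... | no ne' = reach-first-step q ne'

open Walks public

reach-map : ∀ {n} (K K2 : Graph n) (r : Fin n → Fin n) (P : Fin n → Set) →
    (∀ w → P w → vert K w ≡ true → vert K2 (r w) ≡ true) →
    (∀ w z → P w → adj K w z ≡ true → P z × (r w ≡ r z ⊎ adj K2 (r w) (r z) ≡ true)) →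
    ∀ {k x y} → P x → Reach K k x y → P y × Reach K2 k (r x) (r y)
reach-map K K2 r P hv ha {zero} px e with reach-zero K e
... | refl , vx = px , reach-refl K2 (hv _ px vx)
reach-map K K2 r P hv ha {suc k} px e with reach-suc K e
... | inj₁ q with reach-map K K2 r P hv ha px q
... | py , q' = py , reach-mono K2 q'
reach-map K K2 r P hv ha {suc k} px e | inj₂ (w , q , a) with reach-map K K2 r P hv ha px q
... | pw , q' with ha w _ pw a
... | pz , inj₁ eq rewrite eq = pz , reach-mono K2 q'
... | pz , inj₂ a' = pz , reach-step K2 q' a'

reach-sym : ∀ {n} (K : Graph n) → (∀ u v → adj K u v ≡ adj K v u) → (∀ u v → adj K u v ≡ true → vert K v ≡ true) →
  ∀ {k u v} → Reach K k u v → Reach K k v u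
reach-sym K sy av {zero} e with reach-zero K e
... | refl , vu = reach-refl K vu
reach-sym K sy av {suc k} {u} {v} e with reach-suc K e
... | inj₁ x = reach-mono K (reach-sym K sy av x)
... | inj₂ (w , q , a) = reach-concat K {j = 1} (reach-step K (reach-refl K (av w v a)) (trans (sy v w) a)) (reach-sym K sy av q)

WeakHom : ∀ {n} → Graph n → Graph n → (Fin n → Fin n) → Set
WeakHom K K2 f = ∀ w z → adj K w z ≡ true → f w ≡ f z ⊎ adj K2 (f w) (f z) ≡ true

reach-weakHom : ∀ {n} (K K2 : Graph n) (f : Fin n → Fin n) → (∀ w → vert K w ≡ true → vert K2 (f w) ≡ true) →
  WeakHom K K2 f → ∀ {k x y} → Reach K k x y → Reach K2 k (f x) (f y)
reach-weakHom K K2 f hv hf r = proj₂ (reach-map K K2 f (λ _ → ⊤) (λ w _ → hv w) (λ w z _ e → tt , hf w z e) tt r)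

module Shortening {n : ℕ} (K : Graph n) where

  StableAt : Fin n → ℕ → Set
  StableAt u k = ∀ v → Reach K (suc k) u v → Reach K k u v

  stable-forever : ∀ {u k} → StableAt u k → ∀ t {v} → Reach K t u v → Reach K k u v
  stable-forever st zero e with reach-zero K e
  ... | refl , vu = reach-le K z≤n (reach-refl K vu)
  stable-forever st (suc t) e with reach-suc K e
  ... | inj₁ x = stable-forever st t x
  ... | inj₂ (w , q , a) = st _ (reach-step K (stable-forever st t q) a)

  reachCount : Fin n → ℕ → ℕ
  reachCount u k = sum (λ v → [ reach K k u v ])

  GrowsOrStable : Fin n → ℕ → Set
  GrowsOrStable u k = StableAt u k ⊎ suc k ≤ reachCount u k

  -- The set reachable within k steps grows strictly until it stabilises, so by
  -- k = n − 1 it has stabilised: no walk needs more than n − 1 steps.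
  grows-or-stable : ∀ {u} → vert K u ≡ true → ∀ k → GrowsOrStable u k
  grows-or-stable {u} vu zero = inj₂ (≤-trans (subst (λ b → 1 ≤ [ b ]) (sym (get (reach-refl K vu))) ≤-refl) (term≤sum _ u))
  grows-or-stable {u} vu (suc k) with anyF (λ v → reach K (suc k) u v ∧ not (reach K k u v)) in eq
  ... | false = inj₁ (λ v e → reach-mono K (stable-forever st (suc (suc k)) e))
    where
    st : StableAt u k
    st v r with reach K k u v in eq2
    ... | true = mkR eq2
    ... | false = ⊥-elim (t≢f (anyF-intro (λ v → reach K (suc k) u v ∧ not (reach K k u v)) v (∧-i (get r) (not-f eq2))) eq)
  ... | true with anyF-elim _ eq
  ... | x , px with grows-or-stable vu k
  ... | inj₁ st = ⊥-elim (t≢f (get (st x (mkR (∧-l _ _ px)))) (not-t _ (∧-r (reach K (suc k) u x) _ px)))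
  ... | inj₂ le = inj₂ (≤-trans (s≤s le) (count-mono-< _ _ (λ v e → get (reach-mono K {k = k} {u = u} (mkR e))) x (not-t _ (∧-r (reach K (suc k) u x) _ px)) (∧-l _ _ px)))

reach-shorten : ∀ {n'} (K : Graph (suc n')) {u v} t → Reach K t u v → Reach K n' u v
reach-shorten {n'} K {u} {v} t e with Shortening.grows-or-stable K (reach-src K e) n'
... | inj₁ st = Shortening.stable-forever K st t e
... | inj₂ le = mkR (count-full (λ w → reach K n' u w) le v)

findFrom-le : ∀ (p : ℕ → Bool) s f j → p j ≡ true → s ≤ j → findFrom p s f ≤ j
findFrom-le p s zero j pj le = le
findFrom-le p s (suc f) j pj le with p s in eq
... | true = le
... | false with m≤n⇒m<n∨m≡n le
... | inj₁ lt = findFrom-le p (suc s) f j pj lt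
... | inj₂ refl = ⊥-elim (t≢f pj eq)

findFrom-sound : ∀ (p : ℕ → Bool) s f j → p j ≡ true → s ≤ j → j < s + f → p (findFrom p s f) ≡ true
findFrom-sound p s zero j pj le lt = ⊥-elim (<-irrefl refl (≤-trans lt (subst (_≤ j) (sym (+-identityʳ s)) le)))
findFrom-sound p s (suc f) j pj le lt with p s in eq
... | true = eq
... | false with m≤n⇒m<n∨m≡n le
... | inj₁ lt' = findFrom-sound p (suc s) f j pj lt' (subst (j <_) (+-suc s f) lt)
... | inj₂ refl = ⊥-elim (t≢f pj eq)

Joined : ∀ {n} → Graph n → Fin n → Fin n → Set
Joined K u v = ∃ λ k → Reach K k u v

module Distance {n' : ℕ} (K : Graph (suc n')) where
  nn = suc n'

  dist-le : ∀ {j u v} → Reach K j u v → dist K u v ≤ j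
  dist-le {j} {u} {v} e = findFrom-le (λ k → reach K k u v) 0 nn j (get e) z≤n

  dist-reach : ∀ {u v} → Joined K u v → Reach K (dist K u v) u v
  dist-reach {u} {v} (j , e) = mkR (findFrom-sound (λ k → reach K k u v) 0 nn n' (get (reach-shorten K j e)) z≤n ≤-refl)

  dist-step : ∀ {u w v} → Joined K u w → adj K w v ≡ true → dist K u v ≤ suc (dist K u w)
  dist-step c a = dist-le (reach-step K (dist-reach c) a)

  dist-tri : ∀ {u w v} → Joined K u w → Joined K w v → dist K u v ≤ dist K u w + dist K w v
  dist-tri c d = dist-le (reach-concat K (dist-reach c) (dist-reach d))

  dist-self : ∀ {u} → vert K u ≡ true → dist K u u ≡ 0
  dist-self vu = n≤0⇒n≡0 (dist-le (reach-refl K vu))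

  dist≡0⇒≡ : ∀ {u v} → Joined K u v → dist K u v ≡ 0 → u ≡ v
  dist≡0⇒≡ c e = proj₁ (reach-zero K (subst (λ k → Reach K k _ _) e (dist-reach c)))

  joined-trans : ∀ {u w v} → Joined K u w → Joined K w v → Joined K u v
  joined-trans (j , p) (k , q) = j + k , reach-concat K p q

open Distance public

module Separator {n' : ℕ} (K : Graph (suc n')) (vt : ∀ v → vert K v ≡ true) (conK : ∀ x y → Joined K x y)
  (p : Fin (suc n') → Bool) (s : Fin (suc n'))
  (crs : ∀ w z → p w ≡ true → p z ≡ false → adj K w z ≡ true → w ≡ s) where

  walk-through-separator : ∀ {x} → p x ≡ true → ∀ k z → Reach K k x z → p z ≡ false → dist K x s + dist K s z ≤ k
  walk-through-separator px zero z r pz with reach-zero K r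
  ... | refl , _ = ⊥-elim (t≢f px pz)
  walk-through-separator {x} px (suc k) z r pz with reach-suc K r
  ... | inj₁ q = ≤-trans (walk-through-separator px k z q pz) (n≤1+n k)
  ... | inj₂ (w , q , e) = bcase (p w) yes' no'
    where
    yes' : p w ≡ true → dist K x s + dist K s z ≤ suc k
    yes' pw with crs w z pw pz e
    ... | refl = subst (λ t → dist K x w + dist K w z ≤ t) (+-comm k 1) (+-mono-≤ (dist-le K q) (dist-le K (reach-step K (reach-refl K (vt w)) e)))
    no' : p w ≡ false → dist K x s + dist K s z ≤ suc k
    no' pw = ≤-trans (+-monoʳ-≤ (dist K x s) (dist-step K (conK s w) e))
               (subst (_≤ suc k) (sym (+-suc (dist K x s) (dist K s w))) (s≤s (walk-through-separator px k w q pw)))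

  dist-through-separator : ∀ {x z} → p x ≡ true → p z ≡ false → dist K x z ≡ dist K x s + dist K s z
  dist-through-separator {x} {z} px pz = ≤-antisym (dist-tri K (conK x s) (conK s z)) (walk-through-separator px _ z (dist-reach K (conK x z)) pz)

dist-sym : ∀ {n'} (K : Graph (suc n')) → (∀ u v → adj K u v ≡ adj K v u) → (∀ u v → adj K u v ≡ true → vert K v ≡ true) →
  (∀ x y → Joined K x y) → ∀ x y → dist K x y ≡ dist K y x
dist-sym K sy av conK x y = ≤-antisym (dist-le K (reach-sym K sy av (dist-reach K (conK y x))))
                                      (dist-le K (reach-sym K sy av (dist-reach K (conK x y))))

module Components {n' : ℕ} (K : Graph (suc n'))
  (sy : ∀ u v → adj K u v ≡ adj K v u) (av : ∀ u v → adj K u v ≡ true → vert K v ≡ true) where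

  N = suc n'

  IsLeast : Fin N → Bool
  IsLeast v = vert K v ∧ not (anyF (λ u → (toℕ u <ᵇ toℕ v) ∧ reach K N u v))

  numComp≡count : numComp K ≡ sum (λ v → [ IsLeast v ])
  numComp≡count = countF-sum IsLeast

  joined⇒reach : ∀ {x y} → Joined K x y → reach K N x y ≡ true
  joined⇒reach (k , r) = get (reach-le K (n≤1+n n') (reach-shorten K k r))

  joined-sym : ∀ {x y} → Joined K x y → Joined K y x
  joined-sym (k , r) = k , reach-sym K sy av r

  least-not-joined-below : ∀ {r1 r2} → IsLeast r2 ≡ true → toℕ r1 < toℕ r2 → Joined K r1 r2 → ⊥
  least-not-joined-below {r1} {r2} rp lt cn = t≢f (anyF-intro (λ u → (toℕ u <ᵇ toℕ r2) ∧ reach K N u r2) r1 (∧-i (<⇒<ᵇ≡true lt) (joined⇒reach cn))) (not-t _ (∧-r (vert K r2) _ rp))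

  least-joined⇒≡ : ∀ {r1 r2} → IsLeast r1 ≡ true → IsLeast r2 ≡ true → Joined K r1 r2 → r1 ≡ r2
  least-joined⇒≡ {r1} {r2} p1 p2 cn with <-cmp (toℕ r1) (toℕ r2)
  ... | tri< lt _ _ = ⊥-elim (least-not-joined-below p2 lt cn)
  ... | tri≈ _ e _ = toℕ-injective e
  ... | tri> _ _ gt = ⊥-elim (least-not-joined-below p1 gt (joined-sym cn))

  leastOfData : ∀ x → vert K x ≡ true → Σ (Fin N) λ w → reach K N w x ≡ true × (∀ u → toℕ u < toℕ w → reach K N u x ≡ false)
  leastOfData x vx = leastFin (λ w → reach K N w x) (get (reach-le K {j = N} {u = x} {v = x} z≤n (reach-refl K vx)))

  leastOf : ∀ x → vert K x ≡ true → Fin N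
  leastOf x vx = proj₁ (leastOfData x vx)

  leastOf-joined : ∀ x vx → Joined K (leastOf x vx) x
  leastOf-joined x vx = N , mkR (proj₁ (proj₂ (leastOfData x vx)))

  leastOf-IsLeast : ∀ x vx → IsLeast (leastOf x vx) ≡ true
  leastOf-IsLeast x vx = ∧-i (reach-src K (proj₂ (leastOf-joined x vx))) (not-f (bcase (anyF (λ u → (toℕ u <ᵇ toℕ w) ∧ reach K N u w)) (λ t → ⊥-elim (go (anyF-elim _ t))) id))
    where
    w = leastOf x vx
    go : (∃ λ u → ((toℕ u <ᵇ toℕ w) ∧ reach K N u w) ≡ true) → ⊥
    go (u , q) = t≢f (joined⇒reach (joined-trans K (N , mkR (∧-r (toℕ u <ᵇ toℕ w) _ q)) (leastOf-joined x vx))) (proj₂ (proj₂ (leastOfData x vx)) u (<ᵇ≡true⇒< _ _ (∧-l _ _ q)))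

  numComp≤1 : (∀ u v → vert K u ≡ true → vert K v ≡ true → Joined K u v) → numComp K ≤ 1
  numComp≤1 cn = subst (_≤ 1) (sym numComp≡count) (count≤1 IsLeast (λ i j pi pj → least-joined⇒≡ pi pj (cn i j (∧-l _ _ pi) (∧-l _ _ pj))))

  numComp≥1 : ∀ x → vert K x ≡ true → 1 ≤ numComp K
  numComp≥1 x vx = subst (1 ≤_) (sym numComp≡count) (count≥1 IsLeast _ (leastOf-IsLeast x vx))

  numComp≥2 : ∀ x y vx vy → (Joined K x y → ⊥) → 2 ≤ numComp K
  numComp≥2 x y vx vy ncn = subst (2 ≤_) (sym numComp≡count) (count≥2 IsLeast _ _ (leastOf-IsLeast x vx) (leastOf-IsLeast y vy)
    (λ e → ncn (joined-trans K (joined-sym (leastOf-joined x vx)) (subst (λ z → Joined K z y) (sym e) (leastOf-joined y vy)))))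

  -- Sending the least vertex of each component to the first anchor it is joined
  -- to is injective, so m anchors and at least m components force each anchor
  -- to be the first one in its component.
  module Anchors {m} (c : Fin m → Fin N) (anchored : ∀ x → ∃ λ i → Joined K x (c i)) (m≤ : m ≤ numComp K) where

    Earliest : Fin m → Bool
    Earliest i = not (anyF (λ j → (toℕ j <ᵇ toℕ i) ∧ reach K N (c j) (c i)))

    firstData : ∀ r → Σ (Fin m) λ w → reach K N r (c w) ≡ true × (∀ u → toℕ u < toℕ w → reach K N r (c u) ≡ false)
    firstData r = leastFin (λ j → reach K N r (c j)) (joined⇒reach (proj₂ (anchored r)))

    first : Fin N → Fin m
    first r = proj₁ (firstData r)

    first-con : ∀ r → Joined K r (c (first r))
    first-con r = N , mkR (proj₁ (proj₂ (firstData r)))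

    first-Earliest : ∀ r → Earliest (first r) ≡ true
    first-Earliest r = not-f (anyF-false _ λ j → bcase ((toℕ j <ᵇ toℕ (first r)) ∧ reach K N (c j) (c (first r)))
      (λ t → ⊥-elim (t≢f (joined⇒reach (joined-trans K (first-con r) (joined-sym (N , mkR (∧-r (toℕ j <ᵇ toℕ (first r)) _ t)))))
                         (proj₂ (proj₂ (firstData r)) j (<ᵇ≡true⇒< _ _ (∧-l _ _ t))))) id)

    first-inj : ∀ r₁ r₂ → IsLeast r₁ ≡ true → IsLeast r₂ ≡ true → first r₁ ≡ first r₂ → r₁ ≡ r₂
    first-inj r₁ r₂ p₁ p₂ e = least-joined⇒≡ p₁ p₂ (joined-trans K (first-con r₁) (joined-sym (subst (λ i → Joined K r₂ (c i)) (sym e) (first-con r₂))))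

    allEarliest : ∀ i → Earliest i ≡ true
    allEarliest = count-full Earliest (≤-trans m≤ (subst (_≤ count Earliest) (sym numComp≡count)
                    (count-injection IsLeast Earliest first (λ r _ → first-Earliest r) first-inj)))

    joined-earlier : ∀ {i j} → toℕ i < toℕ j → Joined K (c i) (c j) → ⊥
    joined-earlier {i} {j} lt cn = t≢f (anyF-intro (λ i' → (toℕ i' <ᵇ toℕ j) ∧ reach K N (c i') (c j)) i (∧-i (<⇒<ᵇ≡true lt) (joined⇒reach cn)))
                                       (not-t _ (allEarliest j))

    anchors-separated : ∀ {i j} → Joined K (c i) (c j) → i ≡ j
    anchors-separated {i} {j} cn with <-cmp (toℕ i) (toℕ j)
    ... | tri< lt _ _ = ⊥-elim (joined-earlier lt cn)
    ... | tri≈ _ e _ = toℕ-injective e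
    ... | tri> _ _ gt = ⊥-elim (joined-earlier gt (joined-sym cn))

delV-symmetric : ∀ {n} (K : Graph n) v → (∀ u w → adj K u w ≡ adj K w u) → ∀ u w → adj (delV K v) u w ≡ adj (delV K v) w u
delV-symmetric K v sy u w rewrite sy u w = cong (adj K w u ∧_) (∧-comm (not (u == v)) (not (w == v)))

delV-adj⇒vert : ∀ {n} (K : Graph n) v → (∀ u w → adj K u w ≡ true → vert K w ≡ true) → ∀ u w → adj (delV K v) u w ≡ true → vert (delV K v) w ≡ true
delV-adj⇒vert K v av u w e = ∧-i (av u w (∧-l _ _ e)) (∧-r (not (u == v)) _ (∧-r (adj K u w) _ e))

-- The edge Wiener index as a sum over oriented edges

⊓-transpose : ∀ a b c d → (a ⊓ b) ⊓ (c ⊓ d) ≡ (a ⊓ c) ⊓ (b ⊓ d)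
⊓-transpose a b c d = trans (⊓-assoc a b (c ⊓ d)) (trans (cong (a ⊓_) (trans (sym (⊓-assoc b c d)) (trans (cong (_⊓ d) (⊓-comm b c)) (⊓-assoc c b d))))
               (sym (⊓-assoc a c (b ⊓ d))))

sumPairs-double : ∀ {A : Set} (f : A → A → ℕ) → (∀ x y → f x y ≡ f y x) → ∀ L →
  lsum (λ x → lsum (f x) L) L ≡ 2 * sumPairs f L + lsum (λ x → f x x) L
sumPairs-double f fs [] = refl
sumPairs-double {A} f fs (x ∷ L) = begin
    (f x x + lsum (f x) L) + lsum (λ y → f y x + lsum (f y) L) L
  ≡⟨ cong ((f x x + lsum (f x) L) +_) (trans (lsum-+ L) (cong (_+ lsum (λ y → lsum (f y) L) L) (lsum-cong L (λ y → fs y x)))) ⟩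
    (f x x + lsum (f x) L) + (lsum (f x) L + lsum (λ y → lsum (f y) L) L)
  ≡⟨ cong ((f x x + lsum (f x) L) +_) (cong (lsum (f x) L +_) (sumPairs-double f fs L)) ⟩
    (f x x + lsum (f x) L) + (lsum (f x) L + (2 * sumPairs f L + lsum (λ y → f y y) L))
  ≡⟨ solve 5 (λ a b c d e → (a :+ b) :+ (b :+ (con 2 :* d :+ e)) := con 2 :* (b :+ d) :+ (a :+ e)) refl (f x x) (lsum (f x) L) 0 (sumPairs f L) (lsum (λ y → f y y) L) ⟩
    2 * (lsum (f x) L + sumPairs f L) + (f x x + lsum (λ y → f y y) L)
  ∎
  where
  open ≡-Reasoning
  open import Data.Nat.Solver using (module +-*-Solver)
  open +-*-Solver
  lsum-+ : ∀ {g h : A → ℕ} L → lsum (λ y → g y + h y) L ≡ lsum g L + lsum h L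
  lsum-+ [] = refl
  lsum-+ {g} {h} (y ∷ L) rewrite lsum-+ {g} {h} L = interchange (g y) (h y) _ _

lsum-if : ∀ {A : Set} (F : A → ℕ) b (e : A) → lsum F (if b then e ∷ [] else []) ≡ [ b ] * F e
lsum-if F true e = refl
lsum-if F false e = refl

module EdgeSums {n : ℕ} (K : Graph n)
  (sy : ∀ u v → adj K u v ≡ adj K v u) (lp : ∀ u → adj K u u ≡ false)
  (dsym : ∀ x y → dist K x y ≡ dist K y x) (dself : ∀ x → dist K x x ≡ 0) where

  ∑E : (Fin n → Fin n → ℕ) → ℕ
  ∑E F = sum (λ u → sum (λ v → [ adj K u v ] * F u v))

  lt : Fin n → Fin n → Bool
  lt u v = (toℕ u <ᵇ toℕ v) ∧ adj K u v

  edges-sum : ∀ (F : Edge n → ℕ) → lsum F (edges K) ≡ sum (λ u → sum (λ v → [ lt u v ] * F (u , v)))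
  edges-sum F = trans (lsum-concatMap F _ (allFin n))
    (trans (lsum-allFin n _) (sum-cong-≗ (λ u → trans (lsum-concatMap F _ (allFin n))
      (trans (lsum-allFin n _) (sum-cong-≗ (λ v → lsum-if F (lt u v) (u , v)))))))

  notlt : ∀ {a b} → a < suc b → (b <ᵇ a) ≡ false
  notlt {a} {b} l' = bcase (b <ᵇ a) (λ t → ⊥-elim (<-irrefl refl (≤-trans (s≤s (<ᵇ≡true⇒< b a t)) l'))) id

  [adj]-oriented : ∀ u v → [ adj K u v ] ≡ [ lt u v ] + [ lt v u ]
  [adj]-oriented u v with <-cmp (toℕ u) (toℕ v)
  ... | tri< l _ g rewrite <⇒<ᵇ≡true l | sy v u | notlt (<-trans l (n<1+n _)) = sym (+-identityʳ _)
  ... | tri≈ _ e _ rewrite toℕ-injective e | lp v | ∧-zeroʳ (toℕ v <ᵇ toℕ v) = refl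
  ... | tri> _ _ g rewrite <⇒<ᵇ≡true g | sy v u | notlt (<-trans g (n<1+n _)) = refl

  ∑E-half : ∀ (F : Fin n → Fin n → ℕ) → (∀ u v → F u v ≡ F v u) →
    ∑E F ≡ 2 * sum (λ u → sum (λ v → [ lt u v ] * F u v))
  ∑E-half F Fs = begin
      sum (λ u → sum (λ v → [ adj K u v ] * F u v))
    ≡⟨ sum-cong-≗ (λ u → trans (sum-cong-≗ (λ v → trans (cong (_* F u v) ([adj]-oriented u v)) (*-distribʳ-+ (F u v) [ lt u v ] [ lt v u ])))
                       (∑-distrib-+ (λ v → [ lt u v ] * F u v) (λ v → [ lt v u ] * F u v))) ⟩
      sum (λ u → sum (λ v → [ lt u v ] * F u v) + sum (λ v → [ lt v u ] * F u v))
    ≡⟨ ∑-distrib-+ (λ u → sum (λ v → [ lt u v ] * F u v)) (λ u → sum (λ v → [ lt v u ] * F u v)) ⟩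
      X + sum (λ u → sum (λ v → [ lt v u ] * F u v))
    ≡⟨ cong (X +_) (trans (∑-comm (λ u v → [ lt v u ] * F u v)) (sum-cong-≗ (λ v → sum-cong-≗ (λ u → cong ([ lt v u ] *_) (Fs u v))))) ⟩
      X + X
    ≡⟨ cong (X +_) (sym (+-identityʳ X)) ⟩
      2 * X
    ∎
    where
    open ≡-Reasoning
    X = sum (λ u → sum (λ v → [ lt u v ] * F u v))

  ∑E-edges : ∀ (F : Edge n → ℕ) → (∀ u v → F (u , v) ≡ F (v , u)) → ∑E (λ u v → F (u , v)) ≡ 2 * lsum F (edges K)
  ∑E-edges F Fs = trans (∑E-half (λ u v → F (u , v)) Fs) (cong (2 *_) (sym (edges-sum F)))

  ed : Edge n → Edge n → ℕ
  ed = edist K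

  ed-sym : ∀ e f → ed e f ≡ ed f e
  ed-sym (u1 , u2) (v1 , v2) = cong suc (trans (⊓-transpose (dist K u1 v1) (dist K u1 v2) (dist K u2 v1) (dist K u2 v2))
    (cong₂ _⊓_ (cong₂ _⊓_ (dsym u1 v1) (dsym u2 v1)) (cong₂ _⊓_ (dsym u1 v2) (dsym u2 v2))))

  ed-swapl : ∀ u v f → ed (u , v) f ≡ ed (v , u) f
  ed-swapl u v (v1 , v2) = cong suc (⊓-comm (dist K u v1 ⊓ dist K u v2) _)

  ed-swapr : ∀ e u v → ed e (u , v) ≡ ed e (v , u)
  ed-swapr e u v = trans (ed-sym e (u , v)) (trans (ed-swapl u v e) (ed-sym (v , u) e))

  ed-self : ∀ e → ed e e ≡ 1
  ed-self (u , v) rewrite dself u = refl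

  numEdges : ℕ
  numEdges = lsum (λ _ → 1) (edges K)

  ∑E²edist : ℕ
  ∑E²edist = ∑E (λ u v → ∑E (λ u' v' → ed (u , v) (u' , v')))

  -- Each unordered pair of distinct edges occurs 8 times, each edge paired
  -- with itself 4 times at distance 1.
  ∑E²edist≡8We+4m : ∑E²edist ≡ 8 * We K + 2 * ∑E (λ _ _ → 1)
  ∑E²edist≡8We+4m = begin
      ∑E (λ u v → ∑E (λ u' v' → ed (u , v) (u' , v')))
    ≡⟨ sum-cong-≗ (λ u → sum-cong-≗ (λ v → cong ([ adj K u v ] *_) (∑E-edges (ed (u , v)) (λ u' v' → ed-swapr (u , v) u' v')))) ⟩
      ∑E (λ u v → 2 * lsum (ed (u , v)) (edges K))
    ≡⟨ ∑E-edges (λ e → 2 * lsum (ed e) (edges K)) (λ u v → cong (2 *_) (lsum-cong (edges K) (λ f → ed-swapl u v f))) ⟩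
      2 * lsum (λ e → 2 * lsum (ed e) (edges K)) (edges K)
    ≡⟨ cong (2 *_) (lsum-* (edges K)) ⟩
      2 * (2 * lsum (λ e → lsum (ed e) (edges K)) (edges K))
    ≡⟨ cong (λ z → 2 * (2 * z)) (sumPairs-double ed ed-sym (edges K)) ⟩
      2 * (2 * (2 * We K + lsum (λ e → ed e e) (edges K)))
    ≡⟨ cong (λ z → 2 * (2 * (2 * We K + z))) (lsum-cong (edges K) ed-self) ⟩
      2 * (2 * (2 * We K + numEdges))
    ≡⟨ solve 2 (λ w e → con 2 :* (con 2 :* (con 2 :* w :+ e)) := con 8 :* w :+ con 2 :* (con 2 :* e)) refl (We K) numEdges ⟩
      8 * We K + 2 * (2 * numEdges)
    ≡⟨ cong (λ z → 8 * We K + 2 * z) (sym (∑E-edges (λ _ → 1) (λ _ _ → refl))) ⟩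
      8 * We K + 2 * ∑E (λ _ _ → 1)
    ∎
    where
    open ≡-Reasoning
    open import Data.Nat.Solver using (module +-*-Solver)
    open +-*-Solver
    lsum-* : ∀ {g : Edge n → ℕ} L → lsum (λ y → 2 * g y) L ≡ 2 * lsum g L
    lsum-* [] = refl
    lsum-* {g} (y ∷ L) rewrite lsum-* {g} L = sym (*-distribˡ-+ 2 (g y) (lsum g L))

-- The branches of G − E(C)

module CycleSetting (n' m' : ℕ) (a : Fin (suc n') → Fin (suc n') → Bool) (c : Fin (suc m') → Fin (suc n'))
  (wf : WellFormed (full a)) (conG : Connected (full a)) (m'≥2 : 2 ≤ m')
  (cinj : ∀ i j → c i ≡ c j → i ≡ j) (cedge : ∀ i → a (c i) (c (next i)) ≡ true)
  (ncomp : numComp (minusCyc a c) ≡ suc m') where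

  n = suc n'
  m = suc m'
  G = full a
  H = minusCyc a c
  G' = transform a c
  C = cycleGraph c

  a-sym : ∀ u v → a u v ≡ a v u
  a-sym = proj₁ wf
  a-loop : ∀ u → a u u ≡ false
  a-loop = proj₁ (proj₂ wf)

  cyc-elim : ∀ {u v} → cycE c u v ≡ true → ∃ λ i → (c i ≡ u × c (next i) ≡ v) ⊎ (c i ≡ v × c (next i) ≡ u)
  cyc-elim {u} {v} e with anyF-elim _ e
  ... | i , q with ∨-elim ((c i == u) ∧ (c (next i) == v)) _ q
  ... | inj₁ x = i , inj₁ (==-sound (∧-l _ _ x) , ==-sound (∧-r (c i == u) _ x))
  ... | inj₂ y = i , inj₂ (==-sound (∧-l _ _ y) , ==-sound (∧-r (c i == v) _ y))

  cyc-i : ∀ i → cycE c (c i) (c (next i)) ≡ true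
  cyc-i i = anyF-intro _ i (∨-l _ (∧-i (==-refl (c i)) (==-refl (c (next i)))))

  cyc-i' : ∀ i → cycE c (c (next i)) (c i) ≡ true
  cyc-i' i = anyF-intro (λ j → ((c j == c (next i)) ∧ (c (next j) == c i)) ∨ ((c j == c i) ∧ (c (next j) == c (next i)))) i
               (∨-r ((c i == c (next i)) ∧ (c (next i) == c i)) (∧-i (==-refl (c i)) (==-refl (c (next i)))))

  cyc-a : ∀ {u v} → cycE c u v ≡ true → a u v ≡ true
  cyc-a e with cyc-elim e
  ... | i , inj₁ (refl , refl) = cedge i
  ... | i , inj₂ (refl , refl) = trans (a-sym _ _) (cedge i)

  Hadj : Fin n → Fin n → Bool
  Hadj u v = a u v ∧ not (cycE c u v)

  cyc-sym : ∀ u v → cycE c u v ≡ cycE c v u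
  cyc-sym u v with bdec (cycE c u v) | bdec (cycE c v u)
  ... | inj₁ e1 | inj₁ e2 = trans e1 (sym e2)
  ... | inj₂ e1 | inj₂ e2 = trans e1 (sym e2)
  ... | inj₁ e1 | inj₂ e2 with cyc-elim e1
  ... | i , inj₁ (refl , refl) = ⊥-elim (t≢f (cyc-i' i) e2)
  ... | i , inj₂ (refl , refl) = ⊥-elim (t≢f (cyc-i i) e2)
  cyc-sym u v | inj₂ e1 | inj₁ e2 with cyc-elim e2
  ... | i , inj₁ (refl , refl) = ⊥-elim (t≢f (cyc-i' i) e1)
  ... | i , inj₂ (refl , refl) = ⊥-elim (t≢f (cyc-i i) e1)

  H-sym : ∀ u v → Hadj u v ≡ Hadj v u
  H-sym u v rewrite a-sym u v | cyc-sym u v = refl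

  a-split : ∀ {u v} → a u v ≡ true → cycE c u v ≡ true ⊎ Hadj u v ≡ true
  a-split {u} {v} e with bdec (cycE c u v)
  ... | inj₁ t = inj₁ t
  ... | inj₂ f = inj₂ (∧-i e (not-f f))

  H-a : ∀ {u v} → Hadj u v ≡ true → a u v ≡ true
  H-a e = ∧-l _ _ e

  H-reach-sym : ∀ {k u v} → Reach H k u v → Reach H k v u
  H-reach-sym = reach-sym H H-sym (λ _ _ _ → refl)

  H-edge-joined : ∀ {u v} → Hadj u v ≡ true → Joined H u v
  H-edge-joined e = 1 , reach-step H (reach-refl H refl) e

  H-joined-refl : ∀ u → Joined H u u
  H-joined-refl u = 0 , reach-refl H refl

  H-joined-sym : ∀ {u v} → Joined H u v → Joined H v u
  H-joined-sym (k , r) = k , H-reach-sym r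

  reach⇒joined-cycle : ∀ {k x} → Reach G k (c fzero) x → ∃ λ i → Joined H x (c i)
  reach⇒joined-cycle {zero} r with reach-zero G r
  ... | refl , _ = fzero , H-joined-refl _
  reach⇒joined-cycle {suc k} r with reach-suc G r
  ... | inj₁ q = reach⇒joined-cycle q
  ... | inj₂ (w , q , e) with reach⇒joined-cycle q | a-split e
  ... | i , cw | inj₁ ce with cyc-elim ce
  ... | j , inj₁ (_ , refl) = next j , H-joined-refl _
  ... | j , inj₂ (refl , _) = j , H-joined-refl _
  reach⇒joined-cycle {suc k} r | inj₂ (w , q , e) | i , cw | inj₂ he = i , joined-trans H (H-joined-sym (H-edge-joined he)) cw

  joined-cycle : ∀ x → ∃ λ i → Joined H x (c i)
  joined-cycle x = reach⇒joined-cycle {k = n} (mkR (conG (c fzero) x refl refl))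

  -- Abstract, since unfolding root into the walk it is read off from makes
  -- type checking the rest of the development impractically slow.
  abstract
    root : Fin n → Fin m
    root x = proj₁ (joined-cycle x)

    root-joined : ∀ x → Joined H x (c (root x))
    root-joined x = proj₂ (joined-cycle x)

  cycle-joined⇒≡ : ∀ {i j} → Joined H (c i) (c j) → i ≡ j
  cycle-joined⇒≡ = Components.Anchors.anchors-separated H H-sym (λ _ _ _ → refl) c joined-cycle (≤-reflexive (sym ncomp))

  root-unique : ∀ {x j} → Joined H x (c j) → root x ≡ j
  root-unique {x} cn = cycle-joined⇒≡ (joined-trans H (H-joined-sym (root-joined x)) cn)

  root-c : ∀ j → root (c j) ≡ j
  root-c j = root-unique (H-joined-refl _)

  root-H-edge : ∀ {u v} → Hadj u v ≡ true → root u ≡ root v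
  root-H-edge {u} {v} e = sym (root-unique (joined-trans H (H-joined-sym (H-edge-joined e)) (root-joined u)))

  H-irrefl : ∀ {u} → Hadj u u ≡ true → ⊥
  H-irrefl {u} e = t≢f (H-a e) (a-loop u)

  H-no-chord : ∀ {i j} → Hadj (c i) (c j) ≡ true → ⊥
  H-no-chord {i} {j} e with cinj i j (trans (cong c (trans (sym (root-c i)) (trans (root-H-edge e) (root-c j)))) refl)
  ... | refl = H-irrefl e

  onC : Fin n → Bool
  onC x = anyF (λ i → c i == x)

  onC-c : ∀ i → onC (c i) ≡ true
  onC-c i = anyF-intro (λ j → c j == c i) i (==-refl (c i))

  onC⇒c-root : ∀ {x} → onC x ≡ true → x ≡ c (root x)
  onC⇒c-root {x} e with anyF-elim (λ j → c j == x) e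
  ... | i , q = trans (sym (==-sound q)) (cong c (sym (trans (cong root (sym (==-sound q))) (root-c i))))

  offC⇒≢c : ∀ {x} → onC x ≡ false → ∀ i → ¬ c i ≡ x
  offC⇒≢c {x} e i refl = t≢f (onC-c i) e

  root-change⇒cycE : ∀ {u v} → a u v ≡ true → ¬ root u ≡ root v → cycE c u v ≡ true
  root-change⇒cycE e ne with a-split e
  ... | inj₁ x = x
  ... | inj₂ y = ⊥-elim (ne (root-H-edge y))

  cycE⇒onC : ∀ {u v} → cycE c u v ≡ true → onC u ≡ true × onC v ≡ true
  cycE⇒onC e with cyc-elim e
  ... | i , inj₁ (refl , refl) = onC-c i , onC-c (next i)
  ... | i , inj₂ (refl , refl) = onC-c (next i) , onC-c i

  root-change⇒c-root : ∀ {u v} → a u v ≡ true → ¬ root u ≡ root v → u ≡ c (root u)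
  root-change⇒c-root e ne = onC⇒c-root (proj₁ (cycE⇒onC (root-change⇒cycE e ne)))

  H-no-chord′ : ∀ {u v} → Hadj u v ≡ true → onC u ≡ true → onC v ≡ true → ⊥
  H-no-chord′ {u} {v} e cu cv = H-no-chord (subst₂ (λ x y → Hadj x y ≡ true) (onC⇒c-root cu) (onC⇒c-root cv) e)

  removed : Fin n → Fin n → Bool
  removed x y = anyF (λ i → isNonzero i ∧ (((c i == x) ∧ Hadj x y) ∨ ((c i == y) ∧ Hadj y x)))

  added : Fin n → Fin n → Bool
  added x y = ((x == c fzero) ∧ anyF (λ i → isNonzero i ∧ Hadj (c i) y)) ∨
            ((y == c fzero) ∧ anyF (λ i → isNonzero i ∧ Hadj (c i) x))

  G'-def : ∀ x y → adj G' x y ≡ ((a x y ∧ not (removed x y)) ∨ added x y)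
  G'-def x y = refl

  removed-sym : ∀ x y → removed x y ≡ removed y x
  removed-sym x y = anyF-cong (λ i → cong (isNonzero i ∧_) (∨-comm ((c i == x) ∧ Hadj x y) _))

  added-sym : ∀ x y → added x y ≡ added y x
  added-sym x y = ∨-comm ((x == c fzero) ∧ anyF (λ i → isNonzero i ∧ Hadj (c i) y)) _

  G'-sym : ∀ x y → adj G' x y ≡ adj G' y x
  G'-sym x y = trans (G'-def x y) (trans (cong₂ _∨_ (cong₂ (λ p q → p ∧ not q) (a-sym x y) (removed-sym x y)) (added-sym x y)) (sym (G'-def y x)))

  -- merge maps an edge of G − E(C) to the edge of G' that replaces it.
  merge : Fin n → Fin n
  merge z = if onC z then c fzero else z

  merge-c : ∀ i → merge (c i) ≡ c fzero
  merge-c i rewrite onC-c i = refl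

  merge-offC : ∀ {z} → onC z ≡ false → merge z ≡ z
  merge-offC e rewrite e = refl

  isNonzero⇒≢0 : ∀ (i : Fin m) → isNonzero i ≡ true → ¬ i ≡ fzero
  isNonzero⇒≢0 i e refl = t≢f e refl

  ≢0⇒isNonzero : ∀ (i : Fin m) → ¬ i ≡ fzero → isNonzero i ≡ true
  ≢0⇒isNonzero i ne = not-f (==-false ne)

  merge-fixes-kept : ∀ {x y} → Hadj x y ≡ true → removed x y ≡ false → merge x ≡ x
  merge-fixes-kept {x} {y} e r with bdec (onC x)
  ... | inj₂ f = merge-offC f
  ... | inj₁ t with root x ≟ fzero
  ... | yes z = trans (trans (π-c' t) (cong c (sym z))) (sym (onC⇒c-root t))
    where
          π-c' : onC x ≡ true → merge x ≡ c fzero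
          π-c' t rewrite t = refl
  ... | no nz = ⊥-elim (t≢f (anyF-intro (λ i → isNonzero i ∧ (((c i == x) ∧ Hadj x y) ∨ ((c i == y) ∧ Hadj y x))) (root x)
                     (∧-i (≢0⇒isNonzero _ nz) (∨-l _ (∧-i (subst (λ z → (z == x) ≡ true) (onC⇒c-root t) (==-refl x)) e)))) r)

  G'-elim : ∀ {x y} → adj G' x y ≡ true →
    cycE c x y ≡ true ⊎ Σ (Fin n) λ u → Σ (Fin n) λ v → Hadj u v ≡ true × merge u ≡ x × merge v ≡ y
  G'-elim {x} {y} e with ∨-elim (a x y ∧ not (removed x y)) (added x y) e
  ... | inj₁ q with a-split (∧-l _ _ q)
  ... | inj₁ ce = inj₁ ce
  ... | inj₂ he = inj₂ (x , y , he , merge-fixes-kept he (not-t _ (∧-r (a x y) _ q)) ,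
                         merge-fixes-kept (trans (H-sym y x) he) (trans (removed-sym y x) (not-t _ (∧-r (a x y) _ q))))
  G'-elim {x} {y} e | inj₂ q with ∨-elim ((x == c fzero) ∧ anyF (λ i → isNonzero i ∧ Hadj (c i) y)) _ q
  ... | inj₁ q1 with anyF-elim _ (∧-r (x == c fzero) _ q1)
  ... | i , qi = inj₂ (c i , y , ∧-r (isNonzero i) _ qi , trans (merge-c i) (sym (==-sound (∧-l _ _ q1))) ,
                       merge-offC (nc (∧-r (isNonzero i) _ qi)))
    where nc : Hadj (c i) y ≡ true → onC y ≡ false
          nc he with bdec (onC y)
          ... | inj₂ f = f
          ... | inj₁ t = ⊥-elim (H-no-chord′ he (onC-c i) t)
  G'-elim {x} {y} e | inj₂ q | inj₂ q2 with anyF-elim _ (∧-r (y == c fzero) _ q2)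
  ... | i , qi = inj₂ (x , c i , trans (H-sym x (c i)) (∧-r (isNonzero i) _ qi) , merge-offC (nc (∧-r (isNonzero i) _ qi)) ,
                       trans (merge-c i) (sym (==-sound (∧-l _ _ q2))))
    where nc : Hadj (c i) x ≡ true → onC x ≡ false
          nc he with bdec (onC x)
          ... | inj₂ f = f
          ... | inj₁ t = ⊥-elim (H-no-chord′ he (onC-c i) t)

  G'-intro-C : ∀ {x y} → cycE c x y ≡ true → adj G' x y ≡ true
  G'-intro-C {x} {y} ce = ∨-l (added x y) (∧-i (cyc-a ce) (not-f (anyF-false _ λ i → z i)))
    where
    hf : ∀ {u v} → cycE c u v ≡ true → Hadj u v ≡ false
    hf {u} {v} ce' rewrite ce' = ∧-zeroʳ (a u v)
    z : ∀ i → (isNonzero i ∧ (((c i == x) ∧ Hadj x y) ∨ ((c i == y) ∧ Hadj y x))) ≡ false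
    z i rewrite hf ce | hf (trans (cyc-sym y x) ce) = ∧-zero' (isNonzero i) (c i == x) (c i == y)
      where ∧-zero' : ∀ p q r → (p ∧ ((q ∧ false) ∨ (r ∧ false))) ≡ false
            ∧-zero' false q r = refl
            ∧-zero' true false false = refl
            ∧-zero' true false true = refl
            ∧-zero' true true false = refl
            ∧-zero' true true true = refl

  merge-onC : ∀ {u} → onC u ≡ true → merge u ≡ c fzero
  merge-onC t rewrite t = refl

  removed-false : ∀ {x y} → (∀ i → isNonzero i ≡ true → ¬ c i ≡ x) → (∀ i → isNonzero i ≡ true → ¬ c i ≡ y) → removed x y ≡ false
  removed-false {x} {y} hx hy = anyF-false _ z
    where
    z : ∀ i → (isNonzero i ∧ (((c i == x) ∧ Hadj x y) ∨ ((c i == y) ∧ Hadj y x))) ≡ false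
    z i with bdec (isNonzero i)
    ... | inj₂ f rewrite f = refl
    ... | inj₁ t rewrite t | ==-false (hx i t) | ==-false (hy i t) = refl

  G'-intro-1 : ∀ {u v} → Hadj u v ≡ true → onC v ≡ false → adj G' (merge u) (merge v) ≡ true
  G'-intro-1 {u} {v} e fv rewrite merge-offC fv with bdec (onC u)
  ... | inj₂ fu rewrite merge-offC fu = ∨-l (added u v) (∧-i (H-a e) (not-f (removed-false (λ i _ → offC⇒≢c fu i) (λ i _ → offC⇒≢c fv i))))
  ... | inj₁ tu with onC⇒c-root tu
  ... | equ rewrite merge-onC tu with root u ≟ fzero
  ... | yes z0 = ∨-l (added (c fzero) v) (∧-i (subst (λ w → a w v ≡ true) (trans equ (cong c z0)) (H-a e))
                   (not-f (removed-false (λ i nz eq → isNonzero⇒≢0 i nz (cinj i fzero eq)) (λ i _ → offC⇒≢c fv i))))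
  ... | no nz = ∨-r ((a (c fzero) v) ∧ not (removed (c fzero) v))
                   (∨-l _ (∧-i (==-refl (c fzero)) (anyF-intro (λ i → isNonzero i ∧ Hadj (c i) v) (root u)
                     (∧-i (≢0⇒isNonzero _ nz) (subst (λ w → Hadj w v ≡ true) equ e)))))

  G'-intro-H : ∀ {u v} → Hadj u v ≡ true → adj G' (merge u) (merge v) ≡ true
  G'-intro-H {u} {v} e with bdec (onC v)
  ... | inj₂ fv = G'-intro-1 e fv
  ... | inj₁ tv with bdec (onC u)
  ... | inj₁ tu = ⊥-elim (H-no-chord′ e tu tv)
  ... | inj₂ fu = trans (G'-sym (merge u) (merge v)) (G'-intro-1 (trans (H-sym v u) e) fu)

  G-joined : ∀ x y → Joined G x y
  G-joined x y = n , mkR (conG x y refl refl)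

  dG = dist G
  dG' = dist G'

  merge-weakHom : WeakHom G G' merge
  merge-weakHom w z e with a-split e
  ... | inj₁ ce = inj₁ (trans (merge-onC (proj₁ (cycE⇒onC ce))) (sym (merge-onC (proj₂ (cycE⇒onC ce)))))
  ... | inj₂ he = inj₂ (G'-intro-H he)

  reach-merge : ∀ {k x y} → Reach G k x y → Reach G' k (merge x) (merge y)
  reach-merge = reach-weakHom G G' merge (λ _ _ → refl) merge-weakHom

  rootVertex : Fin n → Fin n
  rootVertex z = c (root z)

  rootVertex-c : ∀ i → rootVertex (c i) ≡ c i
  rootVertex-c i = cong c (root-c i)

  rootVertex-weakHom : WeakHom G G' rootVertex
  rootVertex-weakHom w z e with a-split e
  ... | inj₂ he = inj₁ (cong c (root-H-edge he))
  ... | inj₁ ce with cycE⇒onC ce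
  ... | cw , cz = inj₂ (G'-intro-C (subst₂ (λ p q → cycE c p q ≡ true) (trans (onC⇒c-root cw) refl) (onC⇒c-root cz) ce))

  reach-rootVertex : ∀ {k x y} → Reach G k x y → Reach G' k (rootVertex x) (rootVertex y)
  reach-rootVertex = reach-weakHom G G' rootVertex (λ _ _ → refl) rootVertex-weakHom

  retract : Fin n → Fin n
  retract z = if onC z then z else c fzero

  retract-merge : ∀ u → retract (merge u) ≡ c fzero
  retract-merge u with bdec (onC u)
  ... | inj₁ t rewrite merge-onC t | onC-c fzero = refl
  ... | inj₂ f rewrite merge-offC f | f = refl

  retract-onC : ∀ {z} → onC z ≡ true → retract z ≡ z
  retract-onC t rewrite t = refl

  retract-weakHom : WeakHom G' G retract
  retract-weakHom w z e with G'-elim e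
  ... | inj₁ ce = inj₂ (subst₂ (λ p q → a p q ≡ true) (sym (retract-onC (proj₁ (cycE⇒onC ce)))) (sym (retract-onC (proj₂ (cycE⇒onC ce)))) (cyc-a ce))
  ... | inj₂ (u , v , he , refl , refl) = inj₁ (trans (retract-merge u) (sym (retract-merge v)))

  reach-retract : ∀ {k x y} → Reach G' k x y → Reach G k (retract x) (retract y)
  reach-retract = reach-weakHom G' G retract (λ _ _ → refl) retract-weakHom

  G'-reach-sym : ∀ {k u v} → Reach G' k u v → Reach G' k v u
  G'-reach-sym = reach-sym G' G'-sym (λ _ _ _ → refl)

  G'-joined-v₁ : ∀ x → Joined G' (c fzero) x
  G'-joined-v₁ x with bdec (onC x)
  ... | inj₁ t = _ , subst₂ (Reach G' _) (rootVertex-c fzero) (sym (onC⇒c-root t)) (reach-rootVertex (proj₂ (G-joined (c fzero) x)))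
  ... | inj₂ f = _ , subst₂ (Reach G' _) (merge-c fzero) (merge-offC f) (reach-merge (proj₂ (G-joined (c fzero) x)))

  G'-joined : ∀ x y → Joined G' x y
  G'-joined x y with G'-joined-v₁ x | G'-joined-v₁ y
  ... | (j , p) | (k , q) = j + k , reach-concat G' (G'-reach-sym p) q

  vG : ∀ v → vert G v ≡ true
  vG v = refl

  dG-sym : ∀ x y → dG x y ≡ dG y x
  dG-sym = dist-sym G a-sym (λ _ _ _ → refl) G-joined

  dG'-sym : ∀ x y → dG' x y ≡ dG' y x
  dG'-sym = dist-sym G' G'-sym (λ _ _ _ → refl) G'-joined

  -- unmerge i undoes merge on the branch at c i and collapses everything else to c i.
  unmerge : Fin m → Fin n → Fin n
  unmerge i z = if onC z then c i else (if root z == i then z else c i)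

  unmerge-onC : ∀ i {z} → onC z ≡ true → unmerge i z ≡ c i
  unmerge-onC i t rewrite t = refl

  unmerge-inside : ∀ {i u} → root u ≡ i → unmerge i (merge u) ≡ u
  unmerge-inside {i} {u} e = bcase (onC u)
    (λ t → trans (cong (unmerge i) (merge-onC t)) (trans (unmerge-onC i (onC-c fzero)) (trans (cong c (sym e)) (sym (onC⇒c-root t)))))
    (λ f → trans (cong (unmerge i) (merge-offC f)) (σ-nc f))
    where
    σ-nc : onC u ≡ false → unmerge i u ≡ u
    σ-nc f rewrite f | e | ==-refl i = refl

  unmerge-outside : ∀ {i u} → ¬ root u ≡ i → unmerge i (merge u) ≡ c i
  unmerge-outside {i} {u} ne = bcase (onC u)
    (λ t → trans (cong (unmerge i) (merge-onC t)) (unmerge-onC i (onC-c fzero)))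
    (λ f → trans (cong (unmerge i) (merge-offC f)) (σ-nc f))
    where
    σ-nc : onC u ≡ false → unmerge i u ≡ c i
    σ-nc f rewrite f | ==-false ne = refl

  unmerge-weakHom : ∀ i → WeakHom G' G (unmerge i)
  unmerge-weakHom i w z e with G'-elim e
  ... | inj₁ ce = inj₁ (trans (unmerge-onC i (proj₁ (cycE⇒onC ce))) (sym (unmerge-onC i (proj₂ (cycE⇒onC ce)))))
  ... | inj₂ (u , v , he , refl , refl) = decide (root u ≟ i)
         (λ e1 → inj₂ (subst₂ (λ p q → a p q ≡ true) (sym (unmerge-inside e1)) (sym (unmerge-inside (trans (sym (root-H-edge he)) e1))) (H-a he)))
         (λ ne → inj₁ (trans (unmerge-outside ne) (sym (unmerge-outside (λ e2 → ne (trans (root-H-edge he) e2))))))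

  reach-unmerge : ∀ i {k x y} → Reach G' k x y → Reach G k (unmerge i x) (unmerge i y)
  reach-unmerge i = reach-weakHom G' G (unmerge i) (λ _ _ → refl) (unmerge-weakHom i)

  dist-merge-≤ : ∀ x y → dG' (merge x) (merge y) ≤ dG x y
  dist-merge-≤ x y = dist-le G' (reach-merge (dist-reach G (G-joined x y)))

  dist-merge-sameRoot : ∀ {x y} → root x ≡ root y → dG' (merge x) (merge y) ≡ dG x y
  dist-merge-sameRoot {x} {y} e = ≤-antisym (dist-merge-≤ x y)
    (subst₂ (λ p q → dG p q ≤ dG' (merge x) (merge y)) (unmerge-inside {root x} {x} refl) (unmerge-inside {root x} {y} (sym e))
      (dist-le G (reach-unmerge (root x) (dist-reach G' (G'-joined (merge x) (merge y))))))

  dist-via-root : ∀ i {x z} → root x ≡ i → ¬ root z ≡ i → dG x z ≡ dG x (c i) + dG (c i) z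
  dist-via-root i {x} {z} ex nz = Separator.dist-through-separator G vG G-joined (λ v → root v == i) (c i) crs (subst (λ t → (t == i) ≡ true) (sym ex) (==-refl i)) (==-false nz)
    where
    crs : ∀ w z → (root w == i) ≡ true → (root z == i) ≡ false → a w z ≡ true → w ≡ c i
    crs w z pw pz e = trans (root-change⇒c-root e (λ q → ==-false' pz (trans (sym q) (==-sound pw)))) (cong c (==-sound pw))

  offC-or-v₁ : Fin n → Bool
  offC-or-v₁ z = not (onC z) ∨ (z == c fzero)

  offC-or-v₁-merge : ∀ u → offC-or-v₁ (merge u) ≡ true
  offC-or-v₁-merge u = bcase (onC u)
    (λ t → subst (λ q → offC-or-v₁ q ≡ true) (sym (merge-onC t)) (∨-r (not (onC (c fzero))) (==-refl (c fzero))))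
    (λ f → subst (λ q → offC-or-v₁ q ≡ true) (sym (merge-offC f)) (∨-l _ (not-f f)))

  dist'-via-v₁ : ∀ {x z} → offC-or-v₁ x ≡ true → offC-or-v₁ z ≡ false → dG' x z ≡ dG' x (c fzero) + dG' (c fzero) z
  dist'-via-v₁ px pz = Separator.dist-through-separator G' (λ _ → refl) G'-joined offC-or-v₁ (c fzero) crs px pz
    where
    crs : ∀ w z → offC-or-v₁ w ≡ true → offC-or-v₁ z ≡ false → adj G' w z ≡ true → w ≡ c fzero
    crs w z pw pz e with G'-elim e
    ... | inj₂ (u , v , he , refl , refl) = ⊥-elim (t≢f (offC-or-v₁-merge v) pz)
    ... | inj₁ ce with ∨-elim (not (onC w)) _ pw
    ... | inj₁ nc = ⊥-elim (t≢f (proj₁ (cycE⇒onC ce)) (not-t _ nc))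
    ... | inj₂ eq = ==-sound eq

  dG-self : ∀ x → dG x x ≡ 0
  dG-self x = dist-self G {x} refl

  dG'-self : ∀ x → dG' x x ≡ 0
  dG'-self x = dist-self G' {x} refl

  dG-pos : ∀ {x y} → ¬ x ≡ y → 1 ≤ dG x y
  dG-pos {x} {y} ne with dG x y in eq
  ... | zero = ⊥-elim (ne (dist≡0⇒≡ G (G-joined x y) eq))
  ... | suc _ = s≤s z≤n

  dist-merge-< : ∀ {x y} → ¬ root x ≡ root y → suc (dG' (merge x) (merge y)) ≤ dG x y
  dist-merge-< {x} {y} ne = begin
      suc (dG' (merge x) (merge y))
    ≤⟨ s≤s (dist-tri G' (G'-joined (merge x) (c fzero)) (G'-joined (c fzero) (merge y))) ⟩
      suc (dG' (merge x) (c fzero) + dG' (c fzero) (merge y))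
    ≡⟨ cong₂ (λ p q → suc (dG' (merge x) p + dG' q (merge y))) (sym (merge-c (root x))) (sym (merge-c (root y))) ⟩
      suc (dG' (merge x) (merge (c (root x))) + dG' (merge (c (root y))) (merge y))
    ≤⟨ s≤s (+-mono-≤ (dist-merge-≤ x (c (root x))) (dist-merge-≤ (c (root y)) y)) ⟩
      suc (dG x (c (root x)) + dG (c (root y)) y)
    ≡⟨ sym (+-suc (dG x (c (root x))) _) ⟩
      dG x (c (root x)) + suc (dG (c (root y)) y)
    ≤⟨ +-monoʳ-≤ (dG x (c (root x))) (+-monoˡ-≤ (dG (c (root y)) y) (dG-pos {c (root x)} {c (root y)} (λ e → ne (cinj _ _ e)))) ⟩
      dG x (c (root x)) + (dG (c (root x)) (c (root y)) + dG (c (root y)) y)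
    ≡⟨ cong (dG x (c (root x)) +_) (sym mid) ⟩
      dG x (c (root x)) + dG (c (root x)) y
    ≡⟨ sym (dist-via-root (root x) refl (λ e → ne (sym e))) ⟩
      dG x y
    ∎
    where
    open ≤-Reasoning
    mid : dG (c (root x)) y ≡ dG (c (root x)) (c (root y)) + dG (c (root y)) y
    mid = trans (dG-sym (c (root x)) y) (trans (dist-via-root (root y) refl (λ e → ne (trans (sym (root-c (root x))) e)))
            (trans (+-comm (dG y (c (root y))) (dG (c (root y)) (c (root x)))) (cong₂ _+_ (dG-sym (c (root y)) (c (root x))) (dG-sym y (c (root y))))))

  dist-c-via-root : ∀ p {z} → dG (c p) z ≡ dG (c p) (c (root z)) + dG (c (root z)) z
  dist-c-via-root p {z} = decide (p ≟ root z)
    (λ e → subst (λ q → dG (c q) z ≡ dG (c q) (c (root z)) + dG (c (root z)) z) (sym e) (sym (cong (_+ dG (c (root z)) z) (dG-self (c (root z))))))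
    (λ ne → trans (dG-sym (c p) z) (trans (dist-via-root (root z) refl (λ e → ne (trans (sym (root-c p)) e))) (trans (+-comm (dG z (c (root z))) (dG (c (root z)) (c p))) (cong₂ _+_ (dG-sym (c (root z)) (c p)) (dG-sym z (c (root z)))))))

  dist'-c-merge : ∀ p z → dG' (c p) (merge z) ≡ dG' (c p) (c fzero) + dG (c (root z)) z
  dist'-c-merge p z = trans step (cong (dG' (c p) (c fzero) +_) (trans (cong (λ q → dG' q (merge z)) (sym (merge-c (root z)))) (dist-merge-sameRoot (root-c (root z)))))
    where
    step : dG' (c p) (merge z) ≡ dG' (c p) (c fzero) + dG' (c fzero) (merge z)
    step = decide (p ≟ fzero)
      (λ e → subst (λ q → dG' (c q) (merge z) ≡ dG' (c q) (c fzero) + dG' (c fzero) (merge z)) (sym e) (cong (_+ dG' (c fzero) (merge z)) (sym (dG'-self (c fzero)))))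
      (λ ne → trans (dG'-sym (c p) (merge z)) (trans (dist'-via-v₁ (offC-or-v₁-merge z) (pc ne)) (trans (+-comm (dG' (merge z) (c fzero)) (dG' (c fzero) (c p))) (cong₂ _+_ (dG'-sym (c fzero) (c p)) (dG'-sym (merge z) (c fzero))))))
      where
      pc : ¬ p ≡ fzero → offC-or-v₁ (c p) ≡ false
      pc ne rewrite onC-c p | ==-false (λ e → ne (cinj p fzero e)) = refl

  dist'-cc : ∀ p q → dG' (c p) (c q) ≡ dG (c p) (c q)
  dist'-cc p q = ≤-antisym
    (subst₂ (λ u v → dG' u v ≤ dG (c p) (c q)) (rootVertex-c p) (rootVertex-c q) (dist-le G' (reach-rootVertex (dist-reach G (G-joined (c p) (c q))))))
    (subst₂ (λ u v → dG u v ≤ dG' (c p) (c q)) (retract-onC (onC-c p)) (retract-onC (onC-c q)) (dist-le G (reach-retract (dist-reach G' (G'-joined (c p) (c q))))))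

  sum-δ₂ : ∀ p q (F : Fin n → Fin n → ℕ) → sum (λ u → sum (λ v → [ (p == u) ∧ (q == v) ] * F u v)) ≡ F p q
  sum-δ₂ p q F = trans (sum-single p (λ u ne → sum-zero (λ v → cong (λ b → [ b ∧ (q == v) ] * F u v) (==-false (λ e → ne (sym e))))))
                  (trans (sum-single q (λ v ne → trans (cong (λ b → [ b ∧ (q == v) ] * F p v) (==-refl p)) (cong (λ b → [ b ] * F p v) (==-false (λ e → ne (sym e))))))
                         (trans (cong (λ b → [ b ∧ (q == q) ] * F p q) (==-refl p)) (trans (cong (λ b → [ b ] * F p q) (==-refl q)) (+-identityʳ (F p q)))))

  Arc : Fin n → Fin n → Fin m → Bool
  Arc u v j = (c j == u) ∧ (c (next j) == v)

  arc-sound : ∀ {u v j} → Arc u v j ≡ true → c j ≡ u × c (next j) ≡ v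
  arc-sound {u} {v} {j} e = ==-sound (∧-l _ _ e) , ==-sound (∧-r (c j == u) _ e)

  arc⇒cycE : ∀ {u v j} → Arc u v j ≡ true → cycE c u v ≡ true
  arc⇒cycE {u} {v} {j} e with arc-sound {u} {v} {j} e
  ... | refl , refl = cyc-i j

  arc-unique : ∀ {u v j j'} → Arc u v j ≡ true → Arc u v j' ≡ true → j' ≡ j
  arc-unique {u} {v} {j} {j'} e e' = cinj j' j (trans (proj₁ (arc-sound {u} {v} {j'} e')) (sym (proj₁ (arc-sound {u} {v} {j} e))))

  arc-not-reversed : ∀ {u v j j'} → Arc u v j ≡ true → Arc v u j' ≡ true → ⊥
  arc-not-reversed {u} {v} {j} {j'} e e' with arc-sound {u} {v} {j} e | arc-sound {v} {u} {j'} e'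
  ... | p1 , p2 | q1 , q2 with cinj j' (next j) (trans q1 (sym p2)) | cinj (next j') j (trans q2 (sym p1))
  ... | refl | r = next2-neq m'≥2 j r

  arcs-none : ∀ u v → (∀ j → Arc u v j ≡ false) → sum (λ j → [ Arc u v j ]) ≡ 0
  arcs-none u v f = sum-zero (λ j → cong [_] (f j))

  arcs-one : ∀ u v j → Arc u v j ≡ true → sum (λ j → [ Arc u v j ]) ≡ 1
  arcs-one u v j e = trans (sum-single j (λ j' ne → cong [_] (bcase (Arc u v j') (λ t → ⊥-elim (ne (arc-unique {u} {v} {j} {j'} e t))) id))) (cong [_] e)

  [cycE]≡arcs : ∀ u v → [ cycE c u v ] ≡ sum (λ j → [ Arc u v j ]) + sum (λ j → [ Arc v u j ])
  [cycE]≡arcs u v = bcase (cycE c u v) yes' no'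
    where
    Af : ∀ u v → cycE c u v ≡ false → ∀ j → Arc u v j ≡ false
    Af u v f j = bcase (Arc u v j) (λ t → ⊥-elim (t≢f (arc⇒cycE {u} {v} {j} t) f)) id
    no' : cycE c u v ≡ false → [ cycE c u v ] ≡ sum (λ j → [ Arc u v j ]) + sum (λ j → [ Arc v u j ])
    no' f = trans (cong [_] f) (sym (cong₂ _+_ (arcs-none u v (Af u v f)) (arcs-none v u (Af v u (trans (cyc-sym v u) f)))))
    yes' : cycE c u v ≡ true → [ cycE c u v ] ≡ sum (λ j → [ Arc u v j ]) + sum (λ j → [ Arc v u j ])
    yes' t with cyc-elim t
    ... | j , inj₁ (p , q) = trans (cong [_] t) (sym (cong₂ _+_ (arcs-one u v j aj) (arcs-none v u (λ j' → bcase (Arc v u j') (λ t' → ⊥-elim (arc-not-reversed {u} {v} {j} {j'} aj t')) id))))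
      where aj : Arc u v j ≡ true
            aj rewrite p | q | ==-refl u | ==-refl v = refl
    ... | j , inj₂ (p , q) = trans (cong [_] t) (sym (cong₂ _+_ (arcs-none u v (λ j' → bcase (Arc u v j') (λ t' → ⊥-elim (arc-not-reversed {v} {u} {j} {j'} aj t')) id)) (arcs-one v u j aj)))
      where aj : Arc v u j ≡ true
            aj rewrite p | q | ==-refl u | ==-refl v = refl

  ∑C : (Fin n → Fin n → ℕ) → ℕ
  ∑C F = sum (λ u → sum (λ v → [ cycE c u v ] * F u v))

  ∑C≡∑arcs : ∀ F → ∑C F ≡ sum (λ j → F (c j) (c (next j)) + F (c (next j)) (c j))
  ∑C≡∑arcs F = begin
      ∑C F
    ≡⟨ sum-cong-≗ (λ u → sum-cong-≗ (λ v → trans (cong (_* F u v) ([cycE]≡arcs u v)) (trans (*-distribʳ-+ (F u v) (sum (λ j → [ Arc u v j ])) _)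
         (cong₂ _+_ (*-distribʳ-sum (F u v) (λ j → [ Arc u v j ])) (*-distribʳ-sum (F u v) (λ j → [ Arc v u j ])))))) ⟩
      sum (λ u → sum (λ v → sum (λ j → [ Arc u v j ] * F u v) + sum (λ j → [ Arc v u j ] * F u v)))
    ≡⟨ sum-cong-≗ (λ u → ∑-distrib-+ (λ v → sum (λ j → [ Arc u v j ] * F u v)) (λ v → sum (λ j → [ Arc v u j ] * F u v))) ⟩
      sum (λ u → sum (λ v → sum (λ j → [ Arc u v j ] * F u v)) + sum (λ v → sum (λ j → [ Arc v u j ] * F u v)))
    ≡⟨ ∑-distrib-+ (λ u → sum (λ v → sum (λ j → [ Arc u v j ] * F u v))) (λ u → sum (λ v → sum (λ j → [ Arc v u j ] * F u v))) ⟩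
      sum (λ u → sum (λ v → sum (λ j → [ Arc u v j ] * F u v))) + sum (λ u → sum (λ v → sum (λ j → [ Arc v u j ] * F u v)))
    ≡⟨ cong₂ _+_ (trans (sum-cong-≗ (λ u → ∑-comm (λ v j → [ Arc u v j ] * F u v))) (∑-comm (λ u j → sum (λ v → [ Arc u v j ] * F u v))))
                 (trans (∑-comm (λ u v → sum (λ j → [ Arc v u j ] * F u v))) (trans (sum-cong-≗ (λ v → ∑-comm (λ u j → [ Arc v u j ] * F u v)))
                        (∑-comm (λ v j → sum (λ u → [ Arc v u j ] * F u v))))) ⟩
      sum (λ j → sum (λ u → sum (λ v → [ Arc u v j ] * F u v))) + sum (λ j → sum (λ v → sum (λ u → [ Arc v u j ] * F u v)))
    ≡⟨ cong₂ _+_ (sum-cong-≗ (λ j → sum-δ₂ (c j) (c (next j)) F)) (sum-cong-≗ (λ j → sum-δ₂ (c j) (c (next j)) (λ v u → F u v))) ⟩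
      sum (λ j → F (c j) (c (next j))) + sum (λ j → F (c (next j)) (c j))
    ≡⟨ sym (∑-distrib-+ (λ j → F (c j) (c (next j))) (λ j → F (c (next j)) (c j))) ⟩
      sum (λ j → F (c j) (c (next j)) + F (c (next j)) (c j))
    ∎
    where open ≡-Reasoning

  -- rotate collapses the branch at c i to c (next i), turning C by one step.
  rotate : Fin n → Fin n
  rotate z = c (next (root z))

  rotate-c : ∀ j → rotate (c j) ≡ c (next j)
  rotate-c j = cong (λ t → c (next t)) (root-c j)

  rotate-weakHom : WeakHom G G rotate
  rotate-weakHom w z e with a-split e
  ... | inj₂ he = inj₁ (cong (λ t → c (next t)) (root-H-edge he))
  ... | inj₁ ce with cyc-elim ce
  ... | j , inj₁ (refl , refl) = inj₂ (subst₂ (λ p q → a p q ≡ true) (sym (rotate-c j)) (sym (rotate-c (next j))) (cedge (next j)))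
  ... | j , inj₂ (refl , refl) = inj₂ (subst₂ (λ p q → a p q ≡ true) (sym (rotate-c (next j))) (sym (rotate-c j)) (trans (a-sym _ _) (cedge (next j))))

  reach-rotate : ∀ {k x y} → Reach G k x y → Reach G k (rotate x) (rotate y)
  reach-rotate = reach-weakHom G G rotate (λ _ _ → refl) rotate-weakHom

  dist-rotate-≤ : ∀ p q → dG (c (next p)) (c (next q)) ≤ dG (c p) (c q)
  dist-rotate-≤ p q = subst₂ (λ u v → dG u v ≤ dG (c p) (c q)) (rotate-c p) (rotate-c q) (dist-le G (reach-rotate (dist-reach G (G-joined (c p) (c q)))))

  dEV : Fin m → Fin n → Fin n → ℕ
  dEV i u v = dG u (c i) ⊓ dG v (c i)

  dAV : Fin m → Fin m → ℕ
  dAV i j = dEV i (c j) (c (next j)) + dEV i (c (next j)) (c j)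

  transmission : Fin m → ℕ
  transmission i = sum (dAV i)

  dAV-rotate : ∀ i j → dAV (next i) (next j) ≤ dAV i j
  dAV-rotate i j = +-mono-≤ (⊓-mono-≤ (dist-rotate-≤ j i) (dist-rotate-≤ (next j) i)) (⊓-mono-≤ (dist-rotate-≤ (next j) i) (dist-rotate-≤ j i))

  transmission-rotate : ∀ i → transmission (next i) ≤ transmission i
  transmission-rotate i = ≤-trans (≤-reflexive (sym (sum-next (dAV (next i))))) (sum-mono-≤ (dAV-rotate i))

  transmission-const : ∀ i → transmission i ≡ transmission fzero
  transmission-const = next-invariant transmission transmission-rotate

  -- Comparing the edge Wiener indices

  merge-≡ : ∀ {u u'} → merge u ≡ merge u' → (u ≡ u') ⊎ (onC u ≡ true × onC u' ≡ true)
  merge-≡ {u} {u'} e = bcase (onC u) (λ t → bcase (onC u') (λ t' → inj₂ (t , t'))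
                      (λ f' → ⊥-elim (t≢f (subst (λ z → onC z ≡ true) (trans (sym (merge-onC t)) (trans e (merge-offC f'))) (onC-c fzero)) f')))
                    (λ f → bcase (onC u') (λ t' → ⊥-elim (t≢f (subst (λ z → onC z ≡ true) (trans (sym (merge-onC t')) (trans (sym e) (merge-offC f))) (onC-c fzero)) f))
                      (λ f' → inj₁ (trans (sym (merge-offC f)) (trans e (merge-offC f')))))

  H'adj : Fin n → Fin n → Bool
  H'adj u v = adj G' u v ∧ not (cycE c u v)

  [a]-split : ∀ u v → [ a u v ] ≡ [ cycE c u v ] + [ Hadj u v ]
  [a]-split u v = bcase (cycE c u v)
    (λ t → trans (cong [_] (cyc-a t)) (sym (trans (cong₂ (λ p q → [ p ] + [ a u v ∧ not q ]) t t) (cong (λ b → 1 + [ b ]) (∧-zeroʳ (a u v))))))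
    (λ f → sym (trans (cong₂ (λ p q → [ p ] + [ a u v ∧ not q ]) f f) (cong [_] (∧-identityʳ (a u v)))))

  [G']-split : ∀ u v → [ adj G' u v ] ≡ [ cycE c u v ] + [ H'adj u v ]
  [G']-split u v = bcase (cycE c u v)
    (λ t → trans (cong [_] (G'-intro-C t)) (sym (trans (cong₂ (λ p q → [ p ] + [ adj G' u v ∧ not q ]) t t) (cong (λ b → 1 + [ b ]) (∧-zeroʳ (adj G' u v))))))
    (λ f → sym (trans (cong₂ (λ p q → [ p ] + [ adj G' u v ∧ not q ]) f f) (cong [_] (∧-identityʳ (adj G' u v)))))

  G'-irrefl : ∀ u → adj G' u u ≡ false
  G'-irrefl u = bcase (adj G' u u) (λ t → ⊥-elim (go t)) id
    where
    go : adj G' u u ≡ true → ⊥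
    go t with G'-elim t
    ... | inj₁ ce = t≢f (cyc-a ce) (a-loop u)
    ... | inj₂ (x , y , he , p , q) with merge-≡ (trans p (sym q))
    ... | inj₁ refl = H-irrefl he
    ... | inj₂ (cx , cy) = H-no-chord′ he cx cy

  ∑H : (Fin n → Fin n → ℕ) → ℕ
  ∑H F = sum (λ u → sum (λ v → [ Hadj u v ] * F u v))

  ∑H' : (Fin n → Fin n → ℕ) → ℕ
  ∑H' F = sum (λ u → sum (λ v → [ H'adj u v ] * F u v))

  module WG = EdgeSums G a-sym a-loop dG-sym dG-self
  module WG' = EdgeSums G' G'-sym G'-irrefl dG'-sym dG'-self

  ∑E-split : ∀ F → WG.∑E F ≡ ∑C F + ∑H F
  ∑E-split F = trans (sum-cong-≗ (λ u → trans (sum-cong-≗ (λ v → trans (cong (_* F u v) ([a]-split u v)) (*-distribʳ-+ (F u v) [ cycE c u v ] [ Hadj u v ])))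
                  (∑-distrib-+ (λ v → [ cycE c u v ] * F u v) (λ v → [ Hadj u v ] * F u v))))
                  (∑-distrib-+ (λ u → sum (λ v → [ cycE c u v ] * F u v)) (λ u → sum (λ v → [ Hadj u v ] * F u v)))

  ∑E'-split : ∀ F → WG'.∑E F ≡ ∑C F + ∑H' F
  ∑E'-split F = trans (sum-cong-≗ (λ u → trans (sum-cong-≗ (λ v → trans (cong (_* F u v) ([G']-split u v)) (*-distribʳ-+ (F u v) [ cycE c u v ] [ H'adj u v ])))
                  (∑-distrib-+ (λ v → [ cycE c u v ] * F u v) (λ v → [ H'adj u v ] * F u v))))
                  (∑-distrib-+ (λ u → sum (λ v → [ cycE c u v ] * F u v)) (λ u → sum (λ v → [ H'adj u v ] * F u v)))

  ∑-comm₄ : ∀ (f : Fin n → Fin n → Fin n → Fin n → ℕ) →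
    sum (λ u → sum (λ v → sum (λ x → sum (λ y → f u v x y)))) ≡ sum (λ x → sum (λ y → sum (λ u → sum (λ v → f u v x y))))
  ∑-comm₄ f = trans (sum-cong-≗ (λ u → ∑-comm (λ v x → sum (λ y → f u v x y))))
           (trans (∑-comm (λ u x → sum (λ v → sum (λ y → f u v x y))))
             (sum-cong-≗ (λ x → trans (sum-cong-≗ (λ u → ∑-comm (λ v y → f u v x y))) (∑-comm (λ u y → sum (λ v → f u v x y))))))

  merge-onC⇒onC : ∀ {u} → onC (merge u) ≡ true → onC u ≡ true
  merge-onC⇒onC {u} t = bcase (onC u) id (λ f → ⊥-elim (t≢f (subst (λ z → onC z ≡ true) (merge-offC f) t) f))

  merge-injective-H : ∀ {u v u' v'} → Hadj u v ≡ true → Hadj u' v' ≡ true → merge u ≡ merge u' → merge v ≡ merge v' → u ≡ u' × v ≡ v'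
  merge-injective-H {u} {v} {u'} {v'} h h' e1 e2 with merge-≡ e1 | merge-≡ e2
  ... | inj₁ p | inj₁ q = p , q
  ... | inj₂ (cu , _) | inj₂ (cv , _) = ⊥-elim (H-no-chord′ h cu cv)
  ... | inj₂ (cu , cu') | inj₁ refl = trans (onC⇒c-root cu) (trans (cong c (trans (root-H-edge h) (sym (root-H-edge h')))) (sym (onC⇒c-root cu'))) , refl
  ... | inj₁ refl | inj₂ (cv , cv') = refl , trans (onC⇒c-root cv) (trans (cong c (trans (sym (root-H-edge h)) (root-H-edge h'))) (sym (onC⇒c-root cv')))

  H'-merge : ∀ {u v} → Hadj u v ≡ true → H'adj (merge u) (merge v) ≡ true
  H'-merge {u} {v} h = ∧-i (G'-intro-H h) (not-f (bcase (cycE c (merge u) (merge v))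
     (λ t → ⊥-elim (H-no-chord′ h (merge-onC⇒onC (proj₁ (cycE⇒onC t))) (merge-onC⇒onC (proj₂ (cycE⇒onC t))))) id))

  H'-elim : ∀ {x y} → H'adj x y ≡ true → Σ (Fin n) λ u → Σ (Fin n) λ v → Hadj u v ≡ true × merge u ≡ x × merge v ≡ y
  H'-elim {x} {y} t with G'-elim (∧-l _ _ t)
  ... | inj₁ ce = ⊥-elim (t≢f ce (not-t _ (∧-r (adj G' x y) _ t)))
  ... | inj₂ r = r

  mergeHit : Fin n → Fin n → Fin n → Fin n → ℕ
  mergeHit x y u v = [ Hadj u v ] * [ (merge u == x) ∧ (merge v == y) ]

  mergeHit-nonzero : ∀ {x y u v} → ¬ mergeHit x y u v ≡ 0 → Hadj u v ≡ true × merge u ≡ x × merge v ≡ y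
  mergeHit-nonzero {x} {y} {u} {v} nz = bcase (Hadj u v)
    (λ t → bcase ((merge u == x) ∧ (merge v == y)) (λ t' → t , ==-sound (∧-l _ _ t') , ==-sound (∧-r (merge u == x) _ t'))
      (λ f' → ⊥-elim (nz (trans (cong₂ (λ p q → [ p ] * [ q ]) t f') refl))))
    (λ f → ⊥-elim (nz (cong (λ p → [ p ] * [ (merge u == x) ∧ (merge v == y) ]) f)))

  ≡0-dec : ∀ k → k ≡ 0 ⊎ ¬ k ≡ 0
  ≡0-dec zero = inj₁ refl
  ≡0-dec (suc k) = inj₂ (λ ())

  mergeHits : ∀ x y → sum (λ u → sum (λ v → mergeHit x y u v)) ≡ [ H'adj x y ]
  mergeHits x y = bcase (H'adj x y) yes' no'
    where
    no' : H'adj x y ≡ false → sum (λ u → sum (λ v → mergeHit x y u v)) ≡ [ H'adj x y ]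
    no' f = trans (sum-zero (λ u → sum-zero (λ v → z u v))) (sym (cong [_] f))
      where z : ∀ u v → mergeHit x y u v ≡ 0
            z u v with ≡0-dec (mergeHit x y u v)
            ... | inj₁ e = e
            ... | inj₂ nz with mergeHit-nonzero {x} {y} {u} {v} nz
            ... | h , refl , refl = ⊥-elim (t≢f (H'-merge h) f)
    yes' : H'adj x y ≡ true → sum (λ u → sum (λ v → mergeHit x y u v)) ≡ [ H'adj x y ]
    yes' t with H'-elim t
    ... | u0 , v0 , h0 , refl , refl = trans (sum-single u0 (λ u ne → sum-zero (λ v → z1 u v ne)))
                                      (trans (sum-single v0 (λ v ne → z2 v ne)) (trans val (sym (cong [_] t))))
      where
      z1 : ∀ u v → ¬ u ≡ u0 → mergeHit (merge u0) (merge v0) u v ≡ 0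
      z1 u v ne with ≡0-dec (mergeHit (merge u0) (merge v0) u v)
      ... | inj₁ e = e
      ... | inj₂ nz with mergeHit-nonzero {merge u0} {merge v0} {u} {v} nz
      ... | h , p , q = ⊥-elim (ne (proj₁ (merge-injective-H h h0 p q)))
      z2 : ∀ v → ¬ v ≡ v0 → mergeHit (merge u0) (merge v0) u0 v ≡ 0
      z2 v ne with ≡0-dec (mergeHit (merge u0) (merge v0) u0 v)
      ... | inj₁ e = e
      ... | inj₂ nz with mergeHit-nonzero {merge u0} {merge v0} {u0} {v} nz
      ... | h , p , q = ⊥-elim (ne (proj₂ (merge-injective-H h h0 p q)))
      val : mergeHit (merge u0) (merge v0) u0 v0 ≡ 1
      val rewrite h0 | ==-refl (merge u0) | ==-refl (merge v0) = refl

  ∑H-merge : ∀ F → ∑H (λ u v → F (merge u) (merge v)) ≡ ∑H' F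
  ∑H-merge F = begin
      sum (λ u → sum (λ v → [ Hadj u v ] * F (merge u) (merge v)))
    ≡⟨ sum-cong-≗ (λ u → sum-cong-≗ (λ v → cong ([ Hadj u v ] *_) (sym (sum-δ₂ (merge u) (merge v) F)))) ⟩
      sum (λ u → sum (λ v → [ Hadj u v ] * sum (λ x → sum (λ y → [ (merge u == x) ∧ (merge v == y) ] * F x y))))
    ≡⟨ sum-cong-≗ (λ u → sum-cong-≗ (λ v → trans (*-distribˡ-sum [ Hadj u v ] (λ x → sum (λ y → [ (merge u == x) ∧ (merge v == y) ] * F x y))) (sum-cong-≗ (λ x → *-distribˡ-sum [ Hadj u v ] (λ y → [ (merge u == x) ∧ (merge v == y) ] * F x y))))) ⟩
      sum (λ u → sum (λ v → sum (λ x → sum (λ y → [ Hadj u v ] * ([ (merge u == x) ∧ (merge v == y) ] * F x y)))))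
    ≡⟨ ∑-comm₄ (λ u v x y → [ Hadj u v ] * ([ (merge u == x) ∧ (merge v == y) ] * F x y)) ⟩
      sum (λ x → sum (λ y → sum (λ u → sum (λ v → [ Hadj u v ] * ([ (merge u == x) ∧ (merge v == y) ] * F x y)))))
    ≡⟨ sum-cong-≗ (λ x → sum-cong-≗ (λ y → trans (sum-cong-≗ (λ u → sum-cong-≗ (λ v → sym (*-assoc [ Hadj u v ] [ (merge u == x) ∧ (merge v == y) ] (F x y)))))
         (trans (sum-cong-≗ (λ u → sym (*-distribʳ-sum (F x y) (λ v → mergeHit x y u v)))) (trans (sym (*-distribʳ-sum (F x y) (λ u → sum (λ v → mergeHit x y u v))))
           (cong (_* F x y) (mergeHits x y)))))) ⟩
      sum (λ x → sum (λ y → [ H'adj x y ] * F x y))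
    ∎
    where open ≡-Reasoning

  edG = WG.ed
  ed' = WG'.ed

  []*-cong : ∀ b {x y : ℕ} → (b ≡ true → x ≡ y) → [ b ] * x ≡ [ b ] * y
  []*-cong true f = cong (1 *_) (f refl)
  []*-cong false f = refl

  []*-mono : ∀ b {x y : ℕ} → (b ≡ true → x ≤ y) → [ b ] * x ≤ [ b ] * y
  []*-mono true f = *-monoʳ-≤ 1 (f refl)
  []*-mono false f = z≤n

  ∑C-cong : ∀ {F F'} → (∀ u v → cycE c u v ≡ true → F u v ≡ F' u v) → ∑C F ≡ ∑C F'
  ∑C-cong h = sum-cong-≗ (λ u → sum-cong-≗ (λ v → []*-cong (cycE c u v) (h u v)))

  ∑H-cong : ∀ {F F'} → (∀ u v → Hadj u v ≡ true → F u v ≡ F' u v) → ∑H F ≡ ∑H F'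
  ∑H-cong h = sum-cong-≗ (λ u → sum-cong-≗ (λ v → []*-cong (Hadj u v) (h u v)))

  ∑H-mono : ∀ {F F'} → (∀ u v → Hadj u v ≡ true → F u v ≤ F' u v) → ∑H F ≤ ∑H F'
  ∑H-mono h = sum-mono-≤ (λ u → sum-mono-≤ (λ v → []*-mono (Hadj u v) (h u v)))

  ∑C-+ : ∀ F F' → ∑C (λ u v → F u v + F' u v) ≡ ∑C F + ∑C F'
  ∑C-+ F F' = trans (sum-cong-≗ (λ u → trans (sum-cong-≗ (λ v → *-distribˡ-+ [ cycE c u v ] (F u v) (F' u v)))
                 (∑-distrib-+ (λ v → [ cycE c u v ] * F u v) (λ v → [ cycE c u v ] * F' u v))))
               (∑-distrib-+ (λ u → sum (λ v → [ cycE c u v ] * F u v)) (λ u → sum (λ v → [ cycE c u v ] * F' u v)))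

  ∑H-+ : ∀ F F' → ∑H (λ u v → F u v + F' u v) ≡ ∑H F + ∑H F'
  ∑H-+ F F' = trans (sum-cong-≗ (λ u → trans (sum-cong-≗ (λ v → *-distribˡ-+ [ Hadj u v ] (F u v) (F' u v)))
                 (∑-distrib-+ (λ v → [ Hadj u v ] * F u v) (λ v → [ Hadj u v ] * F' u v))))
               (∑-distrib-+ (λ u → sum (λ v → [ Hadj u v ] * F u v)) (λ u → sum (λ v → [ Hadj u v ] * F' u v)))

  ∑C∑H-comm : ∀ (F : Fin n → Fin n → Fin n → Fin n → ℕ) → ∑C (λ u v → ∑H (λ x y → F u v x y)) ≡ ∑H (λ x y → ∑C (λ u v → F u v x y))
  ∑C∑H-comm F = begin
      sum (λ u → sum (λ v → [ cycE c u v ] * sum (λ x → sum (λ y → [ Hadj x y ] * F u v x y))))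
    ≡⟨ sum-cong-≗ (λ u → sum-cong-≗ (λ v → trans (*-distribˡ-sum [ cycE c u v ] (λ x → sum (λ y → [ Hadj x y ] * F u v x y)))
         (sum-cong-≗ (λ x → *-distribˡ-sum [ cycE c u v ] (λ y → [ Hadj x y ] * F u v x y))))) ⟩
      sum (λ u → sum (λ v → sum (λ x → sum (λ y → [ cycE c u v ] * ([ Hadj x y ] * F u v x y)))))
    ≡⟨ ∑-comm₄ (λ u v x y → [ cycE c u v ] * ([ Hadj x y ] * F u v x y)) ⟩
      sum (λ x → sum (λ y → sum (λ u → sum (λ v → [ cycE c u v ] * ([ Hadj x y ] * F u v x y)))))
    ≡⟨ sum-cong-≗ (λ x → sum-cong-≗ (λ y → trans (sum-cong-≗ (λ u → sum-cong-≗ (λ v → rearr [ cycE c u v ] [ Hadj x y ] (F u v x y))))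
          (trans (sum-cong-≗ (λ u → sym (*-distribˡ-sum [ Hadj x y ] (λ v → [ cycE c u v ] * F u v x y)))) (sym (*-distribˡ-sum [ Hadj x y ] (λ u → sum (λ v → [ cycE c u v ] * F u v x y))))))) ⟩
      sum (λ x → sum (λ y → [ Hadj x y ] * sum (λ u → sum (λ v → [ cycE c u v ] * F u v x y))))
    ∎
    where
    open ≡-Reasoning
    rearr : ∀ p q r → p * (q * r) ≡ q * (p * r)
    rearr p q r = trans (sym (*-assoc p q r)) (trans (cong (_* r) (*-comm p q)) (*-assoc q p r))

  +-distrib-⊓² : ∀ p q x y → ((p + x) ⊓ (p + y)) ⊓ ((q + x) ⊓ (q + y)) ≡ (p ⊓ q) + (x ⊓ y)
  +-distrib-⊓² p q x y = trans (cong₂ _⊓_ (sym (+-distribˡ-⊓ p x y)) (sym (+-distribˡ-⊓ q x y))) (sym (+-distribʳ-⊓ (x ⊓ y) p q))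

  dist'-onC : ∀ {p q} → onC p ≡ true → onC q ≡ true → dG' p q ≡ dG p q
  dist'-onC {p} {q} cp cq = subst₂ (λ s t → dG' s t ≡ dG s t) (sym (onC⇒c-root cp)) (sym (onC⇒c-root cq)) (dist'-cc (root p) (root q))

  edist-arc-H : ∀ {x y u v} → Hadj x y ≡ true → cycE c u v ≡ true →
    edG (u , v) (x , y) ≡ suc (dEV (root x) u v + (dG (c (root x)) x ⊓ dG (c (root x)) y))
  edist-arc-H {x} {y} {u} {v} h ce = cong suc (trans (cong₂ _⊓_ (cong₂ _⊓_ (du cu x refl) (du cu y (sym (root-H-edge h)))) (cong₂ _⊓_ (du cv x refl) (du cv y (sym (root-H-edge h)))))
      (+-distrib-⊓² (dG u (c (root x))) (dG v (c (root x))) (dG (c (root x)) x) (dG (c (root x)) y)))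
    where
    cu = proj₁ (cycE⇒onC ce)
    cv = proj₂ (cycE⇒onC ce)
    du : ∀ {w} → onC w ≡ true → ∀ z → root z ≡ root x → dG w z ≡ dG w (c (root x)) + dG (c (root x)) z
    du {w} cw z e = subst (λ t → dG t z ≡ dG t (c (root x)) + dG (c (root x)) z) (sym (onC⇒c-root cw))
                      (trans (dist-c-via-root (root w) {z}) (cong (λ s → dG (c (root w)) (c s) + dG (c s) z) e))

  edist'-arc-merge : ∀ {x y u v} → Hadj x y ≡ true → cycE c u v ≡ true →
    ed' (u , v) (merge x , merge y) ≡ suc (dEV fzero u v + (dG (c (root x)) x ⊓ dG (c (root x)) y))
  edist'-arc-merge {x} {y} {u} {v} h ce = cong suc (trans (cong₂ _⊓_ (cong₂ _⊓_ (du cu x refl) (du cu y (sym (root-H-edge h)))) (cong₂ _⊓_ (du cv x refl) (du cv y (sym (root-H-edge h)))))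
      (+-distrib-⊓² (dG u (c fzero)) (dG v (c fzero)) (dG (c (root x)) x) (dG (c (root x)) y)))
    where
    cu = proj₁ (cycE⇒onC ce)
    cv = proj₂ (cycE⇒onC ce)
    du : ∀ {w} → onC w ≡ true → ∀ z → root z ≡ root x → dG' w (merge z) ≡ dG w (c fzero) + dG (c (root x)) z
    du {w} cw z e = subst (λ t → dG' t (merge z) ≡ dG t (c fzero) + dG (c (root x)) z) (sym (onC⇒c-root cw))
                      (trans (dist'-c-merge (root w) z) (cong₂ _+_ (dist'-cc (root w) fzero) (cong (λ s → dG (c s) z) e)))

  ∑C-shift : ∀ F K → ∑C (λ u v → suc (F u v + K)) ≡ ∑C F + ∑C (λ _ _ → suc K)
  ∑C-shift F K = trans (∑C-cong (λ u v _ → sym (+-suc (F u v) K))) (∑C-+ F (λ _ _ → suc K))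

  ∑C-edist'-merge : ∀ {x y} → Hadj x y ≡ true → ∑C (λ u v → ed' (u , v) (merge x , merge y)) ≡ ∑C (λ u v → edG (u , v) (x , y))
  ∑C-edist'-merge {x} {y} h = trans (∑C-cong (λ u v ce → edist'-arc-merge h ce)) (trans (∑C-shift (dEV fzero) M)
      (trans (cong (_+ ∑C (λ _ _ → suc M)) (trans (∑C≡∑arcs (dEV fzero)) (trans (sym (transmission-const (root x))) (sym (∑C≡∑arcs (dEV (root x)))))))
        (trans (sym (∑C-shift (dEV (root x)) M)) (∑C-cong (λ u v ce → sym (edist-arc-H h ce))))))
    where M = dG (c (root x)) x ⊓ dG (c (root x)) y

  ∑E-split-inner : ∀ (E : (Fin n → Fin n → ℕ) → ℕ) (Φ : Fin n → Fin n → Fin n → Fin n → ℕ) → (∀ {F F'} → (∀ u v → F u v ≡ F' u v) → E F ≡ E F') →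
      (∀ F F' → E (λ u v → F u v + F' u v) ≡ E F + E F') →
      E (λ u v → WG.∑E (Φ u v)) ≡ E (λ u v → ∑C (Φ u v)) + E (λ u v → ∑H (Φ u v))
  ∑E-split-inner E Φ ext additive = trans (ext (λ u v → ∑E-split (Φ u v))) (additive (λ u v → ∑C (Φ u v)) (λ u v → ∑H (Φ u v)))

  ∑C-cong′ : ∀ {F F'} → (∀ u v → F u v ≡ F' u v) → ∑C F ≡ ∑C F'
  ∑C-cong′ h = ∑C-cong (λ u v _ → h u v)
  ∑H-cong′ : ∀ {F F'} → (∀ u v → F u v ≡ F' u v) → ∑H F ≡ ∑H F'
  ∑H-cong′ h = ∑H-cong (λ u v _ → h u v)

  edistG : Fin n → Fin n → Fin n → Fin n → ℕ
  edistG u v x y = edG (u , v) (x , y)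

  WCC WCH WHC WHH WCC' WCH' WHC' WHH' : ℕ
  WCC = ∑C (λ u v → ∑C (edistG u v))
  WCH = ∑C (λ u v → ∑H (edistG u v))
  WHC = ∑H (λ u v → ∑C (edistG u v))
  WHH = ∑H (λ u v → ∑H (edistG u v))
  WCC' = ∑C (λ u v → ∑C (λ x y → ed' (u , v) (x , y)))
  WCH' = ∑C (λ u v → ∑H (λ x y → ed' (u , v) (merge x , merge y)))
  WHC' = ∑H (λ u v → ∑C (λ x y → ed' (merge u , merge v) (x , y)))
  WHH' = ∑H (λ u v → ∑H (λ x y → ed' (merge u , merge v) (merge x , merge y)))

  ∑E²edist-split : WG.∑E²edist ≡ (WCC + WCH) + (WHC + WHH)
  ∑E²edist-split = trans (∑E-split (λ u v → WG.∑E (edistG u v)))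
    (cong₂ _+_ (∑E-split-inner ∑C edistG ∑C-cong′ ∑C-+) (∑E-split-inner ∑H edistG ∑H-cong′ ∑H-+))

  ∑E²edist'-split : WG'.∑E²edist ≡ (WCC' + WCH') + (WHC' + WHH')
  ∑E²edist'-split = trans (∑E'-split Ψ) (cong₂ _+_ (trans (∑C-cong′ (λ u v → inner u v)) (∑C-+ (λ u v → ∑C (λ x y → ed' (u , v) (x , y))) (λ u v → ∑H (λ x y → ed' (u , v) (merge x , merge y)))))
     (trans (sym (∑H-merge Ψ)) (trans (∑H-cong′ (λ u v → inner (merge u) (merge v))) (∑H-+ (λ u v → ∑C (λ x y → ed' (merge u , merge v) (x , y))) (λ u v → ∑H (λ x y → ed' (merge u , merge v) (merge x , merge y)))))))
    where
    Ψ : Fin n → Fin n → ℕ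
    Ψ u v = WG'.∑E (λ x y → ed' (u , v) (x , y))
    inner : ∀ u v → Ψ u v ≡ ∑C (λ x y → ed' (u , v) (x , y)) + ∑H (λ x y → ed' (u , v) (merge x , merge y))
    inner u v = trans (∑E'-split (λ x y → ed' (u , v) (x , y))) (cong (∑C (λ x y → ed' (u , v) (x , y)) +_) (sym (∑H-merge (λ x y → ed' (u , v) (x , y)))))

  WCC-eq : WCC' ≡ WCC
  WCC-eq = ∑C-cong (λ u v ce → ∑C-cong (λ x y ce' → cong suc (cong₂ _⊓_
     (cong₂ _⊓_ (dist'-onC (proj₁ (cycE⇒onC ce)) (proj₁ (cycE⇒onC ce'))) (dist'-onC (proj₁ (cycE⇒onC ce)) (proj₂ (cycE⇒onC ce'))))
     (cong₂ _⊓_ (dist'-onC (proj₂ (cycE⇒onC ce)) (proj₁ (cycE⇒onC ce'))) (dist'-onC (proj₂ (cycE⇒onC ce)) (proj₂ (cycE⇒onC ce')))))))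

  WCH-eq : WCH' ≡ WCH
  WCH-eq = trans (∑C∑H-comm (λ u v x y → ed' (u , v) (merge x , merge y))) (trans (∑H-cong (λ x y h → ∑C-edist'-merge h)) (sym (∑C∑H-comm edistG)))

  WHC-eq : WHC' ≡ WHC
  WHC-eq = ∑H-cong (λ u v h → trans (∑C-cong′ (λ x y → WG'.ed-sym (merge u , merge v) (x , y))) (trans (∑C-edist'-merge h) (∑C-cong′ (λ x y → WG.ed-sym (x , y) (u , v)))))

  edist-merge-≤ : ∀ u v x y → ed' (merge u , merge v) (merge x , merge y) ≤ edG (u , v) (x , y)
  edist-merge-≤ u v x y = s≤s (⊓-mono-≤ (⊓-mono-≤ (dist-merge-≤ u x) (dist-merge-≤ u y)) (⊓-mono-≤ (dist-merge-≤ v x) (dist-merge-≤ v y)))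

  WHH-le : WHH' ≤ WHH
  WHH-le = ∑H-mono (λ u v h → ∑H-mono (λ x y h' → edist-merge-≤ u v x y))

  ∑E²edist-le : WG'.∑E²edist ≤ WG.∑E²edist
  ∑E²edist-le = subst₂ _≤_ (sym ∑E²edist'-split) (sym ∑E²edist-split)
    (+-mono-≤ (≤-reflexive (cong₂ _+_ WCC-eq WCH-eq)) (+-mono-≤ (≤-reflexive WHC-eq) WHH-le))

  OneBranch : Set
  OneBranch = ∀ u v x y → Hadj u v ≡ true → Hadj x y ≡ true → root u ≡ root x

  WHH-eq : OneBranch → WHH' ≡ WHH
  WHH-eq sc = ∑H-cong (λ u v h → ∑H-cong (λ x y h' → cong suc (cong₂ _⊓_
     (cong₂ _⊓_ (dist-merge-sameRoot (sc u v x y h h')) (dist-merge-sameRoot (trans (sc u v x y h h') (root-H-edge h'))))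
     (cong₂ _⊓_ (dist-merge-sameRoot (trans (sym (root-H-edge h)) (sc u v x y h h'))) (dist-merge-sameRoot (trans (sym (root-H-edge h)) (trans (sc u v x y h h') (root-H-edge h'))))))))

  ∑E²edist-eq : OneBranch → WG'.∑E²edist ≡ WG.∑E²edist
  ∑E²edist-eq sc = trans ∑E²edist'-split (trans (cong₂ _+_ (cong₂ _+_ WCC-eq WCH-eq) (cong₂ _+_ WHC-eq (WHH-eq sc))) (sym ∑E²edist-split))

  ∑H-≡⇒pointwise : ∀ F F' → (∀ u v → Hadj u v ≡ true → F u v ≤ F' u v) → ∑H F ≡ ∑H F' → ∀ u v → Hadj u v ≡ true → F u v ≡ F' u v
  ∑H-≡⇒pointwise F F' le e u v h = trans (sym (+-identityʳ (F u v))) (trans (cong (λ b → [ b ] * F u v) (sym h))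
      (trans (sum-mono-≤-≡⇒≡ (λ v → []*-mono (Hadj u v) (le u v))
                (sum-mono-≤-≡⇒≡ (λ u → sum-mono-≤ (λ v → []*-mono (Hadj u v) (le u v))) e u) v)
             (trans (cong (λ b → [ b ] * F' u v) h) (+-identityʳ (F' u v)))))

  edist-merge-< : ∀ {u v x y} → Hadj u v ≡ true → Hadj x y ≡ true → ¬ root u ≡ root x → ed' (merge u , merge v) (merge x , merge y) < edG (u , v) (x , y)
  edist-merge-< {u} {v} {x} {y} h h' ne = s≤s (⊓-mono-< (⊓-mono-< (dist-merge-< ne) (dist-merge-< (λ e → ne (trans e (sym (root-H-edge h'))))))
     (⊓-mono-< (dist-merge-< (λ e → ne (trans (root-H-edge h) e))) (dist-merge-< (λ e → ne (trans (root-H-edge h) (trans e (sym (root-H-edge h'))))))))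

  ∑E²edist-eq⇒OneBranch : WG'.∑E²edist ≡ WG.∑E²edist → OneBranch
  ∑E²edist-eq⇒OneBranch e u v x y h h' = decide (root u ≟ root x) id (λ ne → ⊥-elim (<-irrefl eq4 (edist-merge-< h h' ne)))
    where
    p4 : WHH' ≡ WHH
    p4 = +-cancelˡ-≡ WHC WHH' WHH (+-cancelˡ-≡ (WCC + WCH) (WHC + WHH') (WHC + WHH) (trans (sym X) (trans (sym ∑E²edist'-split) (trans e ∑E²edist-split))))
      where X : (WCC' + WCH') + (WHC' + WHH') ≡ (WCC + WCH) + (WHC + WHH')
            X = cong₂ _+_ (cong₂ _+_ WCC-eq WCH-eq) (cong (_+ WHH') WHC-eq)
    eq4 : ed' (merge u , merge v) (merge x , merge y) ≡ edG (u , v) (x , y)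
    eq4 = ∑H-≡⇒pointwise (λ x y → ed' (merge u , merge v) (merge x , merge y)) (edistG u v) (λ x y _ → edist-merge-≤ u v x y)
            (∑H-≡⇒pointwise (λ x' y' → ∑H (λ x y → ed' (merge x' , merge y') (merge x , merge y))) (λ x' y' → ∑H (edistG x' y')) (λ x' y' h'' → ∑H-mono (λ x y _ → edist-merge-≤ x' y' x y)) p4 u v h) x y h'

  numEdges-eq : WG'.∑E (λ _ _ → 1) ≡ WG.∑E (λ _ _ → 1)
  numEdges-eq = trans (∑E'-split (λ _ _ → 1)) (trans (cong (∑C (λ _ _ → 1) +_) (sym (∑H-merge (λ _ _ → 1)))) (sym (∑E-split (λ _ _ → 1))))

  We-transform-≤ : We G' ≤ We G
  We-transform-≤ = *-cancelˡ-≤ 8 (+-cancelʳ-≤ (2 * WG.∑E (λ _ _ → 1)) _ _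
    (subst₂ _≤_ (trans WG'.∑E²edist≡8We+4m (cong (λ z → 8 * We G' + 2 * z) numEdges-eq)) WG.∑E²edist≡8We+4m ∑E²edist-le))

  We-eq⇒OneBranch : We G' ≡ We G → OneBranch
  We-eq⇒OneBranch e = ∑E²edist-eq⇒OneBranch (trans WG'.∑E²edist≡8We+4m (trans (cong₂ (λ p q → 8 * p + 2 * q) e numEdges-eq) (sym WG.∑E²edist≡8We+4m)))

  OneBranch⇒We-eq : OneBranch → We G' ≡ We G
  OneBranch⇒We-eq sc = *-cancelˡ-≡ (We G') (We G) 8 (+-cancelʳ-≡ (2 * WG.∑E (λ _ _ → 1)) _ _
    (trans (sym (trans WG'.∑E²edist≡8We+4m (cong (λ z → 8 * We G' + 2 * z) numEdges-eq))) (trans (∑E²edist-eq sc) WG.∑E²edist≡8We+4m)))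

  -- C is a block; end-blocks

  m'≥1 : 1 ≤ m'
  m'≥1 = ≤-trans (s≤s z≤n) m'≥2

  cycE-irrefl : ∀ u → cycE c u u ≡ false
  cycE-irrefl u = bcase (cycE c u u) (λ t → ⊥-elim (go (cyc-elim t))) id
    where
    go : (∃ λ i → (c i ≡ u × c (next i) ≡ u) ⊎ (c i ≡ u × c (next i) ≡ u)) → ⊥
    go (i , inj₁ (p , q)) = next-neq m'≥1 i (cinj (next i) i (trans q (sym p)))
    go (i , inj₂ (p , q)) = next-neq m'≥1 i (cinj (next i) i (trans q (sym p)))

  cycE⇒onC₂ : ∀ u v → cycE c u v ≡ true → onC v ≡ true
  cycE⇒onC₂ u v e = proj₂ (cycE⇒onC e)

  C-wellFormed : WellFormed C
  C-wellFormed = cyc-sym , cycE-irrefl , (λ u v e → cycE⇒onC e)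

  C⊆G : C ⊆G G
  C⊆G = (λ _ _ → refl) , (λ u v e → cyc-a e)

  C-walk : ∀ t (lt : t < m) → Reach C t (c fzero) (c (fromℕ< lt))
  C-walk zero lt = reach-refl C (onC-c fzero)
  C-walk (suc t) lt = subst (λ z → Reach C (suc t) (c fzero) (c z)) (sym (fromℕ<-suc t lt))
      (reach-step C (C-walk t (≤-trans (n≤1+n (suc t)) lt)) (cyc-i (fromℕ< (≤-trans (n≤1+n (suc t)) lt))))

  C-joined₀ : ∀ j → Joined C (c fzero) (c j)
  C-joined₀ j = toℕ j , subst (λ z → Reach C (toℕ j) (c fzero) (c z)) (fromℕ<-toℕ j (toℕ<n j)) (C-walk (toℕ j) (toℕ<n j))

  C-reach-sym : ∀ {k u v} → Reach C k u v → Reach C k v u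
  C-reach-sym = reach-sym C cyc-sym cycE⇒onC₂

  C-joined : ∀ i j → Joined C (c i) (c j)
  C-joined i j with C-joined₀ i | C-joined₀ j
  ... | (k1 , r1) | (k2 , r2) = k1 + k2 , reach-concat C (C-reach-sym r1) r2

  C-connected : Connected C
  C-connected u v vu vv with C-joined (root u) (root v)
  ... | (k , r) = get (reach-le C (n≤1+n n') (reach-shorten C k (subst₂ (Reach C k) (sym (onC⇒c-root vu)) (sym (onC⇒c-root vv)) r)))

  C-minus : Fin m → Graph n
  C-minus p = delV C (c p)

  c-≢ : ∀ {i p} → ¬ i ≡ p → (c i == c p) ≡ false
  c-≢ ne = ==-false (λ e → ne (cinj _ _ e))

  C-minus-walk : ∀ p d i j → toℕ j ≡ toℕ i + d → (∀ k → toℕ i ≤ toℕ k → toℕ k ≤ toℕ j → ¬ k ≡ p) → Reach (C-minus p) d (c i) (c j)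
  C-minus-walk p zero i j e av with toℕ-injective {i = j} {j = i} (trans e (+-identityʳ _))
  ... | refl = reach-refl (C-minus p) (∧-i (onC-c i) (not-f (c-≢ (av i ≤-refl ≤-refl))))
  C-minus-walk p (suc d) i fzero e av with trans e (+-suc (toℕ i) d)
  ... | ()
  C-minus-walk p (suc d) i (fsuc j'') e av = subst (λ z → Reach (C-minus p) (suc d) (c i) (c z)) (next-inj₁ j'')
      (reach-step (C-minus p) {w = c (inject₁ j'')} {v = c (next (inject₁ j''))}
         (C-minus-walk p d i (inject₁ j'') e' (λ k l1 l2 → av k l1 (≤-trans l2 (≤-trans (≤-reflexive (toℕ-inject₁ j'')) (n≤1+n _)))))
         (∧-i (cyc-i (inject₁ j''))
              (∧-i (not-f (c-≢ (av (inject₁ j'') li (≤-trans (≤-reflexive (toℕ-inject₁ j'')) (n≤1+n _)))))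
                   (not-f (c-≢ (λ q → av (fsuc j'') li2 ≤-refl (trans (sym (next-inj₁ j'')) q)))))))
    where
    e' : toℕ (inject₁ j'') ≡ toℕ i + d
    e' = trans (toℕ-inject₁ j'') (suc-injective (trans e (+-suc (toℕ i) d)))
    li : toℕ i ≤ toℕ (inject₁ j'')
    li = ≤-trans (m≤m+n (toℕ i) d) (≤-reflexive (sym e'))
    li2 : toℕ i ≤ toℕ (fsuc j'')
    li2 = ≤-trans (m≤m+n (toℕ i) (suc d)) (≤-reflexive (sym e))

  C-minus-symmetric : ∀ p u w → adj (C-minus p) u w ≡ adj (C-minus p) w u
  C-minus-symmetric p = delV-symmetric C (c p) cyc-sym
  C-minus-adj⇒vert : ∀ p u w → adj (C-minus p) u w ≡ true → vert (C-minus p) w ≡ true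
  C-minus-adj⇒vert p = delV-adj⇒vert C (c p) cycE⇒onC₂

  C-minus-joined-sym : ∀ p {x y} → Joined (C-minus p) x y → Joined (C-minus p) y x
  C-minus-joined-sym p (k , r) = k , reach-sym (C-minus p) (C-minus-symmetric p) (C-minus-adj⇒vert p) r

  -- C minus c p is connected: along the cycle, every other vertex reaches c (hub p)
  -- without passing c p.
  hub : Fin m → Fin m
  hub fzero = next fzero
  hub (fsuc _) = fzero

  toℕ-next-0 : toℕ (next (fzero {m'})) ≡ 1
  toℕ-next-0 = next-lt fzero (s≤s m'≥1)

  C-minus-joined-hub : ∀ p i → ¬ i ≡ p → Joined (C-minus p) (c i) (c (hub p))
  C-minus-joined-hub fzero fzero ne = ⊥-elim (ne refl)
  C-minus-joined-hub fzero (fsuc i') ne = C-minus-joined-sym fzero (toℕ i' , C-minus-walk fzero (toℕ i') (next fzero) (fsuc i') (cong (_+ toℕ i') (sym toℕ-next-0))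
      (λ k l1 l2 e → <-irrefl refl (≤-trans (subst (λ t → t ≤ toℕ k) toℕ-next-0 l1) (≤-reflexive (cong toℕ e)))))
  C-minus-joined-hub (fsuc p') i ne with <-cmp (toℕ i) (toℕ (fsuc p'))
  ... | tri≈ _ e _ = ⊥-elim (ne (toℕ-injective e))
  ... | tri< lt _ _ = C-minus-joined-sym (fsuc p') (toℕ i , C-minus-walk (fsuc p') (toℕ i) fzero i refl (λ k l1 l2 e → <-irrefl (cong toℕ e) (≤-trans (s≤s l2) lt)))
  ... | tri> _ _ gt = (m' ∸ toℕ i) + 1 , reach-concat (C-minus (fsuc p'))
        (C-minus-walk (fsuc p') (m' ∸ toℕ i) i (fromℕ m') (trans (toℕ-fromℕ m') (sym (m+[n∸m]≡n (≤-pred (toℕ<n i)))))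
           (λ k l1 l2 e → <-irrefl (cong toℕ (sym e)) (≤-trans gt l1)))
        (reach-step (C-minus (fsuc p')) {w = c (fromℕ m')} {v = c fzero} (reach-refl (C-minus (fsuc p')) (∧-i (onC-c (fromℕ m')) (not-f (c-≢ lastne))))
           (∧-i (subst (λ z → cycE c (c (fromℕ m')) (c z) ≡ true) next-last (cyc-i (fromℕ m')))
                (∧-i (not-f (c-≢ lastne)) (not-f (c-≢ (λ ()))))))
    where
    lastne : ¬ fromℕ m' ≡ fsuc p'
    lastne e = <-irrefl refl (≤-trans (subst (_< toℕ i) (trans (sym (cong toℕ e)) (toℕ-fromℕ m')) gt) (≤-pred (toℕ<n i)))

  C-minus-connected : ∀ p u v → vert (C-minus p) u ≡ true → vert (C-minus p) v ≡ true → Joined (C-minus p) u v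
  C-minus-connected p u v vu vv = subst₂ (Joined (C-minus p)) (sym (onC⇒c-root cu)) (sym (onC⇒c-root cv))
      (joined-trans (C-minus p) (C-minus-joined-hub p (root u) (ne cu vu)) (C-minus-joined-sym p (C-minus-joined-hub p (root v) (ne cv vv))))
    where
    cu = ∧-l _ _ vu
    cv = ∧-l _ _ vv
    ne : ∀ {w} → onC w ≡ true → vert (C-minus p) w ≡ true → ¬ root w ≡ p
    ne {w} cw vw e = t≢f (==-refl w) (trans (cong (w ==_) (trans (onC⇒c-root cw) (cong c e))) (not-t _ (∧-r (onC w) _ vw)))

  C-no-cut : ∀ v → ¬ IsCutVertex C v
  C-no-cut v (vv , lt) = <-irrefl refl (≤-trans lt (≤-trans nle (Components.numComp≥1 C cyc-sym cycE⇒onC₂ (c fzero) (onC-c fzero))))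
    where
    nle : numComp (delV C v) ≤ 1
    nle = subst (λ z → numComp (delV C z) ≤ 1) (sym (onC⇒c-root vv))
            (Components.numComp≤1 (C-minus (root v)) (C-minus-symmetric (root v)) (C-minus-adj⇒vert (root v)) (C-minus-connected (root v)))

  C-nonseparable : Nonseparable C
  C-nonseparable = C-connected , C-no-cut

  cycle-vertex-separates : ∀ (S : Graph n) → WellFormed S → S ⊆G G → ∀ i → vert S (c (next i)) ≡ true → ∀ x → root x ≡ i → ¬ x ≡ c i → vert S x ≡ true →
    2 ≤ numComp (delV S (c i))
  cycle-vertex-separates S wfS S⊆G i vn x ex nx vx = Components.numComp≥2 K sy av x (c (next i)) (∧-i vx (not-f (==-false nx))) (∧-i vn (not-f (c-≢ (next-neq m'≥1 i)))) ncn
    where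
    K = delV S (c i)
    sy = delV-symmetric S (c i) (proj₁ wfS)
    av = delV-adj⇒vert S (c i) (λ u w e → proj₂ (proj₂ (proj₂ wfS) u w e))
    ed : ∀ w z → root w ≡ i → adj K w z ≡ true → root z ≡ i × (w ≡ z ⊎ adj K w z ≡ true)
    ed w z pw e = decide (root z ≟ i) (λ pz → pz , inj₂ e)
      (λ nz → ⊥-elim (t≢f (trans (cong (w ==_) (sym (trans (root-change⇒c-root (proj₂ S⊆G w z (∧-l _ _ e)) (λ q → nz (trans (sym q) pw))) (cong c pw)))) (==-refl w))
                           (not-t _ (∧-l _ _ (∧-r (adj S w z) _ e)))))
    ncn : Joined K x (c (next i)) → ⊥
    ncn (k , r) = next-neq m'≥1 i (trans (sym (root-c (next i))) (proj₁ (reach-map K K id (λ w → root w ≡ i) (λ w _ vw → vw) ed ex r)))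

  -- An edge of G − E(C) in S would make c (root u) a cut vertex of S, cutting
  -- its branch off the rest of C.
  C-maximal : ∀ S → WellFormed S → C ⊆G S → S ⊆G G → Nonseparable S → S ⊆G C
  C-maximal S wfS C⊆S S⊆G (conS , ncS) = vpart , apart
    where
    sy = proj₁ wfS
    av : ∀ u w → adj S u w ≡ true → vert S w ≡ true
    av u w e = proj₂ (proj₂ (proj₂ wfS) u w e)
    conS' : ∀ u v → vert S u ≡ true → vert S v ≡ true → Joined S u v
    conS' u v vu vv = n , mkR (conS u v vu vv)
    noH : ∀ u v → adj S u v ≡ true → Hadj u v ≡ true → ⊥
    noH u v e h = ncS (c (root u)) (proj₁ C⊆S (c (root u)) (onC-c (root u)) ,
        ≤-trans (s≤s (Components.numComp≤1 S sy av conS')) (xsep (u ≟ c (root u))))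
      where
      xsep : Relation.Nullary.Dec (u ≡ c (root u)) → 2 ≤ numComp (delV S (c (root u)))
      xsep (yes eq) = cycle-vertex-separates S wfS S⊆G (root u) (proj₁ C⊆S _ (onC-c (next (root u)))) v (sym (root-H-edge h))
                        (λ q → H-irrefl (subst (λ z → Hadj z v ≡ true) (trans eq (sym q)) h)) (av u v e)
      xsep (no ne) = cycle-vertex-separates S wfS S⊆G (root u) (proj₁ C⊆S _ (onC-c (next (root u)))) u refl ne (av v u (trans (sy v u) e))
    vpart : ∀ u → vert S u ≡ true → onC u ≡ true
    vpart u vu = bcase (onC u) id (λ f → ⊥-elim (go f))
      where
      go : onC u ≡ false → ⊥
      go f with reach-first-step S (proj₂ (conS' u (c fzero) vu (proj₁ C⊆S _ (onC-c fzero)))) (λ q → offC⇒≢c f fzero (sym q))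
      ... | w , e with a-split (proj₂ S⊆G u w e)
      ... | inj₁ ce = t≢f (proj₁ (cycE⇒onC ce)) f
      ... | inj₂ h = noH u w e h
    apart : ∀ u v → adj S u v ≡ true → cycE c u v ≡ true
    apart u v e with a-split (proj₂ S⊆G u v e)
    ... | inj₁ ce = ce
    ... | inj₂ h = ⊥-elim (noH u v e h)

  C-isBlock : IsBlock G C
  C-isBlock = C-wellFormed , C⊆G , C-nonseparable , C-maximal

  HasBranch : Fin m → Set
  HasBranch i = Σ (Fin n) λ w → Hadj (c i) w ≡ true

  G⊆G : G ⊆G G
  G⊆G = (λ _ e → e) , (λ _ _ e → e)

  numComp-G≤1 : numComp G ≤ 1
  numComp-G≤1 = Components.numComp≤1 G a-sym (λ _ _ _ → refl) (λ u v _ _ → G-joined u v)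

  branch⇒cut : ∀ i → HasBranch i → IsCutVertex G (c i)
  branch⇒cut i (w , h) = refl , ≤-trans (s≤s numComp-G≤1) (cycle-vertex-separates G wf G⊆G i refl w (trans (sym (root-H-edge h)) (root-c i))
     (λ q → H-irrefl (subst (λ z → Hadj (c i) z ≡ true) q h)) refl)

  no-branch⇒no-cut : ∀ i → ¬ HasBranch i → ¬ IsCutVertex G (c i)
  no-branch⇒no-cut i nt (_ , lt) = <-irrefl refl (≤-trans lt (≤-trans nle (Components.numComp≥1 G a-sym (λ _ _ _ → refl) (c fzero) refl)))
    where
    Gi = delV G (c i)
    syi = delV-symmetric G (c i) a-sym
    avi = delV-adj⇒vert G (c i) (λ _ _ _ → refl)
    ni : ∀ {w} → ¬ root w ≡ i → (w == c i) ≡ false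
    ni {w} ne = ==-false (λ q → ne (trans (cong root q) (root-c i)))
    toT : ∀ z → vert Gi z ≡ true → Joined Gi z (c (next i))
    toT z vz = joined-trans Gi w1 w2
      where
      zne : ¬ z ≡ c i
      zne q = t≢f (==-refl z) (trans (cong (z ==_) q) (not-t _ (∧-r true _ vz)))
      jne : ¬ root z ≡ i
      jne e with root-joined z
      ... | cn with H-joined-sym (subst (λ t → Joined H z (c t)) e cn)
      ... | (k , r) = nt (reach-first-step H r (λ q → zne (sym q)))
      ed1 : ∀ w z' → root w ≡ root z → Hadj w z' ≡ true → root z' ≡ root z × (w ≡ z' ⊎ adj Gi w z' ≡ true)
      ed1 w z' pw h = trans (sym (root-H-edge h)) pw , inj₂ (∧-i (H-a h) (∧-i (not-f (ni (λ q → jne (trans (sym pw) q)))) (not-f (ni (λ q → jne (trans (sym pw) (trans (root-H-edge h) q)))))))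
      w1 : Joined Gi z (c (root z))
      w1 with root-joined z
      ... | (k , r) = k , proj₂ (reach-map H Gi id (λ w → root w ≡ root z) (λ w pw _ → ∧-i refl (not-f (ni (λ q → jne (trans (sym pw) q))))) ed1 refl r)
      C-minus⊆Gi : WeakHom (C-minus i) Gi id
      C-minus⊆Gi w z' e = inj₂ (∧-i (cyc-a (∧-l _ _ e)) (∧-r (cycE c w z') _ e))
      w2 : Joined Gi (c (root z)) (c (next i))
      w2 with C-minus-connected i (c (root z)) (c (next i)) (∧-i (onC-c (root z)) (not-f (c-≢ jne))) (∧-i (onC-c (next i)) (not-f (c-≢ (next-neq m'≥1 i))))
      ... | (k , r) = k , reach-weakHom (C-minus i) Gi id (λ w vw → ∧-i refl (∧-r (onC w) _ vw)) C-minus⊆Gi r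
    nle : numComp Gi ≤ 1
    nle = Components.numComp≤1 Gi syi avi (λ u v vu vv → joined-trans Gi (toT u vu) (Components.joined-sym Gi syi avi (toT v vv)))

  H-edge⇒branch : ∀ {u v} → Hadj u v ≡ true → HasBranch (root u)
  H-edge⇒branch {u} {v} h = decide (u ≟ c (root u)) (λ e → v , subst (λ z → Hadj z v ≡ true) e h)
    (λ ne → let (k , r) = H-joined-sym (root-joined u) in reach-first-step H r (λ q → ne (sym q)))

  HasBranch-dec : ∀ i → HasBranch i ⊎ ¬ HasBranch i
  HasBranch-dec i = bcase (anyF (λ w → Hadj (c i) w)) (λ t → inj₁ (anyF-elim _ t)) (λ f → inj₂ (λ (w , h) → t≢f (anyF-intro (λ w → Hadj (c i) w) w h) f))

  cut⇒branch : ∀ i → IsCutVertex G (c i) → HasBranch i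
  cut⇒branch i cv with HasBranch-dec i
  ... | inj₁ nt = nt
  ... | inj₂ nnt = ⊥-elim (no-branch⇒no-cut i nnt cv)

  OneBranch⇒EndBlock : OneBranch → IsEndBlock G C
  OneBranch⇒EndBlock sc = C-isBlock , λ u v vu vv cu cv → go u v vu vv cu cv
    where
    go : ∀ u v → onC u ≡ true → onC v ≡ true → IsCutVertex G u → IsCutVertex G v → u ≡ v
    go u v vu vv cu cv with cut⇒branch (root u) (subst (IsCutVertex G) (onC⇒c-root vu) cu) | cut⇒branch (root v) (subst (IsCutVertex G) (onC⇒c-root vv) cv)
    ... | (w1 , h1) | (w2 , h2) = trans (onC⇒c-root vu) (trans (cong c (trans (sym (root-c (root u))) (trans (sc _ _ _ _ h1 h2) (root-c (root v))))) (sym (onC⇒c-root vv)))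

  EndBlock⇒OneBranch : IsEndBlock G C → OneBranch
  EndBlock⇒OneBranch (_ , eb) u v x y h h' = cinj _ _ (eb (c (root u)) (c (root x)) (onC-c _) (onC-c _) (branch⇒cut _ (H-edge⇒branch h)) (branch⇒cut _ (H-edge⇒branch h')))

lemma5 : (n k : ℕ) (a : Fin n → Fin n → Bool) (c : Fin (suc (2 * k)) → Fin n) →
    WellFormed (full a) → Connected (full a) → 1 ≤ k →
    (∀ i j → c i ≡ c j → i ≡ j) → (∀ i → a (c i) (c (next i)) ≡ true) →
    numComp (minusCyc a c) ≡ suc (2 * k) →
    (We (transform a c) ≤ We (full a)) ×
    ((We (transform a c) ≡ We (full a) → IsEndBlock (full a) (cycleGraph c)) ×
    (IsEndBlock (full a) (cycleGraph c) → We (transform a c) ≡ We (full a)))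
lemma5 zero k a c wf conG k≥1 cinj cedge ncomp with c fzero
... | ()
lemma5 (suc n') k a c wf conG k≥1 cinj cedge ncomp =
  We-transform-≤ , (λ e → OneBranch⇒EndBlock (We-eq⇒OneBranch e)) , (λ eb → OneBranch⇒We-eq (EndBlock⇒OneBranch eb))
  where
  m'≥2 : 2 ≤ 2 * k
  m'≥2 = *-monoʳ-≤ 2 k≥1
  open CycleSetting n' (2 * k) a c wf conG m'≥2 cinj cedge ncomp
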